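{- For all $k,r\ge 2$ and every $k$-valid pair $(\mathbf j,\sigma)$ with $\mathbf j=(j_1,\dots,j_r)$, \[f_{(\mathbf j,\sigma)}=\min_{1\le i\le r}\left\{\frac{1}{k^kr^{k-1}(rj_i+\sigma)}\sum_{\ell=1}^r j_{\ell,i}\binom{k}{j_{\ell,1},\dots,j_{\ell,r}}\prod_{s=1}^r(rj_s+\sigma)^{j_{\ell,s}}\right\},\] where $j_{\ell,s}$ is the $s$th coordinate of $\mathbf j+\sigma\mathbf e_\ell$, i.e. $j_{\ell,s}=j_s$ if $\ell\ne s$ and $j_{s,s}=j_s+\sigma$.
   Context: A $k$-graph $H$ has vertex set $V(H)$ and edges which are $k$-subsets of $V(H)$; $\delta_1(H)$ is its minimum vertex degree. $\binom{n}{k_1,\dots,k_m}=\frac{n!}{k_1!\cdots k_m!}$ is the multinomial coefficient. Given a partition $\{V_1,\dots,V_r\}$ of $V(H)$, an edge $e$ has type $(t_1,\dots,t_r)$ if $|e\cap V_i|=t_i$ for all $i$; $\mathbf e_i$ is the $i$th standard unit vector of $\mathbb Z^r$. $(\mathbf j,\sigma)$ with $\mathbf j\in\mathbb N_0^r$, $\sigma\in\{ -1,1\}$ is $k$-valid if $\sigma+\sum_i j_i=k$ and $j_i+\sigma\ge0$ for all $i$. An $r$-edge-coloured $k$-graph $H$ is in $\mathcal F_{k,r}(\mathbf j,\sigma)$ if $n=|V(H)|$ is divisible by $kr$ and there is a partition $\{V_1,\dots,V_r\}$ of $V(H)$ with $|V_i|=\frac{rj_i+\sigma}{rk}n$ for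 all $i$ such that for each $i\in[r]$ every edge of colour $i$ has type $\mathbf j+\sigma\mathbf e_i$. Define \[f_{(\mathbf j,\sigma)}:=\lim_{n\to\infty}\max_{H\in\mathcal F_{k,r}(\mathbf j,\sigma),\,|V(H)|=krn}\frac{\delta_1(H)}{\binom{|V(H)|-1}{k-1}}.\] -}

module Defs where

open import Data.Nat as ℕ using (ℕ; zero; suc; _!)
open import Data.Nat.Combinatorics using (_C_)
open import Data.Integer as ℤ using (ℤ; +_; -[1+_])
open import Data.Rational as ℚ using (ℚ; 0ℚ; 1ℚ; _+_; _*_; _÷_; _⊓_; _-_; ≢-nonZero)
open import Data.Rational.Properties using (_≟_)
open import Data.Fin using (Fin; zero; suc)
open import Data.Fin.Subset using (Subset; _∩_; ∣_∣)
open import Data.Vec using (Vec; []; _∷_; lookup)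
open import Data.List using (List; []; _∷_; map; _++_; foldr; allFin)
open import Data.Bool using (Bool; true; false; if_then_else_)
open import Data.Maybe using (Maybe; just; nothing)
open import Data.Product using (Σ; _×_; ∃-syntax)
open import Relation.Nullary using (yes; no)
open import Relation.Nullary.Decidable using (⌊_⌋)
open import Data.Nat.Divisibility using (_∣_)
open import Relation.Binary.PropositionalEquality using (_≡_)

ℤ→ℚ : ℤ → ℚ
ℤ→ℚ z = z ℚ./ 1

ℕ→ℚ : ℕ → ℚ
ℕ→ℚ n = ℤ→ℚ (+ n)

-- division in ℚ; returns 0 when the divisor is 0 (never used with a zero
-- divisor in the statement under its hypotheses)
_÷'_ : ℚ → ℚ → ℚ
p ÷' q with q ≟ 0ℚ
... | yes _ = 0ℚ
... | no q≢0 = _÷_ p q {{≢-nonZero q≢0}}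

sumFin : (r : ℕ) → (Fin r → ℚ) → ℚ
sumFin r f = foldr (λ i acc → f i + acc) 0ℚ (allFin r)

prodFinℕ : (r : ℕ) → (Fin r → ℕ) → ℕ
prodFinℕ r f = foldr (λ i acc → f i ℕ.* acc) 1 (allFin r)

sumFinℕ : (r : ℕ) → (Fin r → ℕ) → ℕ
sumFinℕ r f = foldr (λ i acc → f i ℕ.+ acc) 0 (allFin r)

-- minimum over Fin r of a function (junk value d when r = 0)
minFinWith : {A : Set} → (A → A → A) → A → (r : ℕ) → (Fin r → A) → A
minFinWith _⊓'_ d zero f = d
minFinWith _⊓'_ d (suc zero) f = f zero
minFinWith _⊓'_ d (suc (suc r)) f = f zero ⊓' minFinWith _⊓'_ d (suc r) (λ i → f (suc i))

data Sign : Set where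
  plus minus : Sign

σℤ : Sign → ℤ
σℤ plus = + 1
σℤ minus = -[1+ 0 ]

Valid : (k r : ℕ) → (Fin r → ℕ) → Sign → Set
Valid k r j σ = (σℤ σ ℤ.+ + sumFinℕ r j ≡ + k) × (∀ i → + 0 ℤ.≤ + j i ℤ.+ σℤ σ)

jls : {r : ℕ} → (Fin r → ℕ) → Sign → Fin r → Fin r → ℤ
jls j σ ℓ s with ℓ Data.Fin.≟ s
... | yes _ = + j s ℤ.+ σℤ σ
... | no _ = + j s

multinomial : (n r : ℕ) → (Fin r → ℕ) → ℚ
multinomial n r ks = ℕ→ℚ (n !) ÷' ℕ→ℚ (prodFinℕ r (λ s → ks s !))

rjσ : (r : ℕ) → (Fin r → ℕ) → Sign → Fin r → ℤ
rjσ r j σ s = + (r ℕ.* j s) ℤ.+ σℤ σ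

term : (k r : ℕ) → (Fin r → ℕ) → Sign → Fin r → ℚ
term k r j σ i =
  sumFin r (λ ℓ →
      ℤ→ℚ (jls j σ ℓ i)
    * multinomial k r (λ s → ℤ.∣ jls j σ ℓ s ∣)
    * ℤ→ℚ (foldr (λ s acc → (rjσ r j σ s ℤ.^ ℤ.∣ jls j σ ℓ s ∣) ℤ.* acc) (+ 1) (allFin r)))
  ÷' ℤ→ℚ (+ (k ℕ.^ k ℕ.* r ℕ.^ (k ℕ.∸ 1)) ℤ.* rjσ r j σ i)

target : (k r : ℕ) → (Fin r → ℕ) → Sign → ℚ
target k r j σ = minFinWith _⊓_ 0ℚ r (term k r j σ)

allSubsets : (N : ℕ) → List (Subset N)
allSubsets zero = [] ∷ []
allSubsets (suc N) = map (true ∷_) (allSubsets N) ++ map (false ∷_) (allSubsets N)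

-- a k-graph on Fin N whose edges are coloured with colours in Fin r:
-- colour e = just c  means e is an edge of colour c; nothing means non-edge
record ColKGraph (k r N : ℕ) : Set where
  field
    colour  : Subset N → Maybe (Fin r)
    uniform : ∀ e c → colour e ≡ just c → ∣ e ∣ ≡ k

open ColKGraph public

isEdge : {k r N : ℕ} → ColKGraph k r N → Subset N → Bool
isEdge H e with colour H e
... | just _ = true
... | nothing = false

degree : {k r N : ℕ} → ColKGraph k r N → Fin N → ℕ
degree {N = N} H v =
  foldr (λ e acc → (if isEdge H e then (if lookup e v then 1 else 0) else 0) ℕ.+ acc)
        0 (allSubsets N)

-- minimum vertex degree δ₁(H)  (0 for the empty vertex set)
δ₁ : {k r N : ℕ} → ColKGraph k r N → ℕ
δ₁ {N = N} H = minFinWith ℕ._⊓_ 0 N (degree H)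

normDeg : {k r N : ℕ} → ColKGraph k r N → ℚ
normDeg {k} {N = N} H = ℕ→ℚ (δ₁ H) ÷' ℕ→ℚ ((N ℕ.∸ 1) C (k ℕ.∸ 1))

partSet : {r N : ℕ} → (Fin N → Fin r) → Fin r → Subset N
partSet {N = zero} p i = []
partSet {N = suc N} p i = ⌊ p zero Data.Fin.≟ i ⌋ ∷ partSet (λ v → p (suc v)) i

-- membership in F_{k,r}(j, σ) for H on N vertices (N = k r n):
-- a partition {V_1..V_r} (given by p) with |V_i| = (r j_i + σ)/(r k) · N, and
-- every edge of colour c has type j + σ e_c
InF : (k r : ℕ) → (Fin r → ℕ) → Sign → (N : ℕ) → ColKGraph k r N → Set
InF k r j σ N H =
  ((k ℕ.* r) ∣ N) ×
  (Σ (Fin N → Fin r) λ p →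
     (∀ i → ℕ→ℚ ∣ partSet p i ∣ ≡ (ℤ→ℚ (rjσ r j σ i) ÷' ℕ→ℚ (r ℕ.* k)) * ℕ→ℚ N)
   × (∀ e c → colour H e ≡ just c → ∀ i → + ∣ e ∩ partSet p i ∣ ≡ jls j σ c i))

-- Give the part V_s exactly c_s n vertices, c_s = r j_s + σ, and call (|e ∩ V_s|)_s the type of a set e.
-- Splitting off one vertex at a time shows that a vertex v ∈ V_i lies in t_i / (c_i n) · ∏_s binom(c_s n, t_s)
-- sets of type t. A graph in F(j, σ) only has edges of the r types j + σ e_ℓ, so the degree of v is at most
-- the number D_i of sets through v having one of these types, with equality for the graph of all such sets.
-- Bounding falling factorials between (m - k)^t and m^t gives D_i / binom(krn - 1, k - 1) = term_i + O(1/n)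
-- with explicit constants. The upper bound follows by taking v in a part that minimises the term; the lower
-- bound is attained by the graph of all sets of an allowed type, whose minimum degree is some D_i.
module Submission where

open import Data.Nat.Base
open import Data.Nat.Properties
open import Data.Nat.Combinatorics using (_C_; nCk+nC[k+1]≡[n+1]C[k+1])
open import Data.Nat.Divisibility using (divides)
open import Data.Nat.ListAction using () renaming (sum to sumₗ)
open import Data.Nat.ListAction.Properties using (sum-++)
open import Data.Nat.Tactic.RingSolver using (solve-∀)
import Data.Nat.Coprimality as Coprime
open import Algebra.Properties.Semiring.Sum +-*-semiring
  using (sum; sum-cong-≗; ∑-distrib-+; *-distribˡ-sum; sum-replicate-zero)
open import Algebra.Properties.CommutativeMonoid.Sum *-1-commutativeMonoid
  using () renaming (sum to product; sum-cong-≗ to product-cong-≗; ∑-distrib-+ to product-distrib-*;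
                    sum-replicate-zero to product-replicate-one)
open import Algebra.Properties.CommutativeSemigroup +-commutativeSemigroup using (interchange)
open import Algebra.Properties.CommutativeSemigroup *-commutativeSemigroup
  using () renaming (x∙yz≈y∙xz to x*[y*z]≡y*[x*z])
open import Data.Bool.Base using (true; false; if_then_else_)
open import Data.Fin.Base using (Fin; zero; suc)
import Data.Fin.Properties as Finₚ
open import Data.Fin.Subset using (Subset; _∩_; ∣_∣)
import Data.Integer.Base as ℤ
import Data.Integer.Properties as ℤₚ
import Data.Integer.Tactic.RingSolver as ℤ-Solver
open import Data.List.Base using (foldr; tabulate; allFin)
import Data.List.Base as List using (map; _++_)
import Data.List.Properties as Listₚ
open import Data.Maybe.Base using (Maybe; just; nothing)
open import Data.Product.Base using (∃-syntax; _×_; _,_; proj₁; proj₂)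
import Data.Rational.Base as ℚ
import Data.Rational.Properties as ℚₚ
import Data.Rational.Unnormalised.Base as ℚᵘ
import Data.Rational.Unnormalised.Properties as ℚᵘₚ
open import Data.Sum.Base using (_⊎_; inj₁; inj₂)
open import Data.Vec.Base using (Vec; []; _∷_; lookup)
import Data.Vec.Base as Vec
import Data.Vec.Functional as Vector
open import Function.Base using (_∘_; id)
open import Function.Bundles using (_⇔_; mk⇔; Equivalence)
open import Relation.Binary.PropositionalEquality
open import Relation.Nullary.Decidable using (Dec; yes; no; does; isYes; isYes≗does; dec-true; dec-false; does-⇔)
open import Relation.Nullary.Negation using (¬_; contradiction)
open import Relation.Unary using (Decidable)

open import Defs
  using (ColKGraph; colour; isEdge; degree; δ₁; normDeg; InF; allSubsets; partSet;
         Sign; plus; minus; Valid; jls; rjσ; term; target; multinomial; minFinWith;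
         ℤ→ℚ; ℕ→ℚ; _÷'_; sumFin; sumFinℕ)

1≤m*n⇒1≤n : ∀ m {n} → 1 ≤ m * n → 1 ≤ n
1≤m*n⇒1≤n m {zero}  1≤m*0 = contradiction (≤-trans 1≤m*0 (≤-reflexive (*-zeroʳ m))) λ ()
1≤m*n⇒1≤n m {suc n} _     = s≤s z≤n

1≤m^n : ∀ {m} n → 1 ≤ m → 1 ≤ m ^ n
1≤m^n {m} n 1≤m = subst (_≤ m ^ n) (^-zeroˡ n) (^-monoˡ-≤ n 1≤m)

^-distribʳ-* : ∀ m n o → (m * n) ^ o ≡ m ^ o * n ^ o
^-distribʳ-* m n zero    = refl
^-distribʳ-* m n (suc o) = trans (cong (m * n *_) (^-distribʳ-* m n o)) (rearrange m n (m ^ o) (n ^ o))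
  where
  rearrange : ∀ a b x y → a * b * (x * y) ≡ a * x * (b * y)
  rearrange = solve-∀

m+n≡o⇔n≡o∸m : ∀ {m n o} → m ≤ o → (m + n ≡ o) ⇔ (n ≡ o ∸ m)
m+n≡o⇔n≡o∸m {m} {n} m≤o = mk⇔ (λ eq → trans (sym (m+n∸m≡n m n)) (cong (_∸ m) eq))
                               (λ eq → trans (cong (m +_) eq) (m+[n∸m]≡n m≤o))

≡-cong-⇔ : ∀ {x y t u : ℕ} → x ≡ y → t ≡ u → (x ≡ t) ⇔ (y ≡ u)
≡-cong-⇔ refl refl = mk⇔ (λ eq → eq) (λ eq → eq)

foldr-tabulate : ∀ {A B : Set} {m} (_∙_ : A → B → B) (e : B) (f : Fin m → A) r (h : Fin r → Fin m) →
  foldr (λ i acc → f i ∙ acc) e (tabulate h) ≡ Vector.foldr _∙_ e (f ∘ h)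
foldr-tabulate _∙_ e f zero h = refl
foldr-tabulate _∙_ e f (suc r) h = cong (f (h zero) ∙_) (foldr-tabulate _∙_ e f r (h ∘ suc))

foldr-allFin : ∀ {A B : Set} (_∙_ : A → B → B) (e : B) r (f : Fin r → A) →
  foldr (λ i acc → f i ∙ acc) e (allFin r) ≡ Vector.foldr _∙_ e f
foldr-allFin _∙_ e r f = foldr-tabulate _∙_ e f r id

sumFinℕ≡sum : ∀ r (f : Fin r → ℕ) → sumFinℕ r f ≡ sum f
sumFinℕ≡sum r f = foldr-allFin _+_ 0 r f

sum-mono-≤ : ∀ {r} {f g : Fin r → ℕ} → (∀ i → f i ≤ g i) → sum f ≤ sum g
sum-mono-≤ {zero}  _   = z≤n
sum-mono-≤ {suc r} f≤g = +-mono-≤ (f≤g zero) (sum-mono-≤ (f≤g ∘ suc))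

product-mono-≤ : ∀ {r} {f g : Fin r → ℕ} → (∀ i → f i ≤ g i) → product f ≤ product g
product-mono-≤ {zero}  _   = ≤-refl
product-mono-≤ {suc r} f≤g = *-mono-≤ (f≤g zero) (product-mono-≤ (f≤g ∘ suc))

≤-sum : ∀ {r} (f : Fin r → ℕ) i → f i ≤ sum f
≤-sum f zero    = m≤m+n _ _
≤-sum f (suc i) = ≤-trans (≤-sum (f ∘ suc) i) (m≤n+m _ _)

sum-const : ∀ r c → sum {r} (λ _ → c) ≡ r * c
sum-const zero    c = refl
sum-const (suc r) c = cong (c +_) (sum-const r c)

product-pos : ∀ {r} (f : Fin r → ℕ) → (∀ i → 1 ≤ f i) → 1 ≤ product f
product-pos {zero}  f pos = ≤-refl
product-pos {suc r} f pos = *-mono-≤ (pos zero) (product-pos (f ∘ suc) (pos ∘ suc))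

product-^ : ∀ {r} x (t : Fin r → ℕ) → product (λ i → x ^ t i) ≡ x ^ sum t
product-^ {zero}  x t = refl
product-^ {suc r} x t = trans (cong (x ^ t zero *_) (product-^ x (t ∘ suc)))
  (sym (^-distribˡ-+-* x (t zero) (sum (t ∘ suc))))

𝟙 : ∀ {A : Set} → Dec A → ℕ
𝟙 a? = if does a? then 1 else 0

𝟙-yes : ∀ {A : Set} (a? : Dec A) → A → 𝟙 a? ≡ 1
𝟙-yes a? a = cong (λ b → if b then 1 else 0) (dec-true a? a)

𝟙-no : ∀ {A : Set} (a? : Dec A) → ¬ A → 𝟙 a? ≡ 0
𝟙-no a? ¬a = cong (λ b → if b then 1 else 0) (dec-false a? ¬a)

𝟙-⇔ : ∀ {A B : Set} → A ⇔ B → (a? : Dec A) (b? : Dec B) → 𝟙 a? ≡ 𝟙 b?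
𝟙-⇔ A⇔B a? b? = cong (λ b → if b then 1 else 0) (does-⇔ A⇔B a? b?)

δ : ∀ {r} → Fin r → Fin r → ℕ
δ a s = 𝟙 (a Finₚ.≟ s)

δ-diag : ∀ {r} (a : Fin r) → δ a a ≡ 1
δ-diag a = 𝟙-yes (a Finₚ.≟ a) refl

δ-off : ∀ {r} {a s : Fin r} → ¬ a ≡ s → δ a s ≡ 0
δ-off {a = a} {s} = 𝟙-no (a Finₚ.≟ s)

sum-δ : ∀ {r} (a : Fin r) → sum (δ a) ≡ 1
sum-δ {suc r} zero    = cong suc (sum-replicate-zero r)
sum-δ {suc r} (suc a) = sum-δ a

product-zero : ∀ {r} (f : Fin r → ℕ) i → f i ≡ 0 → product f ≡ 0
product-zero f zero    fi≡0 = cong (_* product (f ∘ suc)) fi≡0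
product-zero f (suc i) fi≡0 = trans (cong (f zero *_) (product-zero (f ∘ suc) i fi≡0)) (*-zeroʳ (f zero))

product-linear-at : ∀ {r} (a : Fin r) {f g h : Fin r → ℕ} →
  (∀ s → ¬ a ≡ s → f s ≡ h s) → (∀ s → ¬ a ≡ s → g s ≡ h s) → h a ≡ f a + g a →
  product h ≡ product f + product g
product-linear-at zero {f} {g} {h} f≗h g≗h ha = begin
  h zero * product (h ∘ suc)
    ≡⟨ cong (_* product (h ∘ suc)) ha ⟩
  (f zero + g zero) * product (h ∘ suc)
    ≡⟨ *-distribʳ-+ (product (h ∘ suc)) (f zero) (g zero) ⟩
  f zero * product (h ∘ suc) + g zero * product (h ∘ suc)
    ≡⟨ cong₂ (λ x y → f zero * x + g zero * y)
         (product-cong-≗ λ s → sym (f≗h (suc s) λ ())) (product-cong-≗ λ s → sym (g≗h (suc s) λ ())) ⟩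
  f zero * product (f ∘ suc) + g zero * product (g ∘ suc) ∎
  where open ≡-Reasoning
product-linear-at (suc a) {f} {g} {h} f≗h g≗h ha = begin
  h zero * product (h ∘ suc)
    ≡⟨ cong (h zero *_) (product-linear-at a (λ s a≢s → f≗h (suc s) (a≢s ∘ Finₚ.suc-injective))
                                             (λ s a≢s → g≗h (suc s) (a≢s ∘ Finₚ.suc-injective)) ha) ⟩
  h zero * (product (f ∘ suc) + product (g ∘ suc))
    ≡⟨ *-distribˡ-+ (h zero) (product (f ∘ suc)) _ ⟩
  h zero * product (f ∘ suc) + h zero * product (g ∘ suc)
    ≡⟨ cong₂ (λ x y → x * product (f ∘ suc) + y * product (g ∘ suc)) (sym (f≗h zero λ ())) (sym (g≗h zero λ ())) ⟩
  f zero * product (f ∘ suc) + g zero * product (g ∘ suc) ∎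
  where open ≡-Reasoning

product-scale-at : ∀ {r} (a : Fin r) {f g : Fin r → ℕ} x y →
  (∀ s → ¬ a ≡ s → f s ≡ g s) → x * f a ≡ y * g a → x * product f ≡ y * product g
product-scale-at zero {f} {g} x y f≗g xfa≡yga = begin
  x * (f zero * product (f ∘ suc)) ≡⟨ *-assoc x (f zero) _ ⟨
  x * f zero * product (f ∘ suc)   ≡⟨ cong₂ _*_ xfa≡yga (product-cong-≗ λ s → f≗g (suc s) λ ()) ⟩
  y * g zero * product (g ∘ suc)   ≡⟨ *-assoc y (g zero) _ ⟩
  y * (g zero * product (g ∘ suc)) ∎
  where open ≡-Reasoning
product-scale-at (suc a) {f} {g} x y f≗g xfa≡yga = begin
  x * (f zero * product (f ∘ suc)) ≡⟨ x*[y*z]≡y*[x*z] x (f zero) _ ⟩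
  f zero * (x * product (f ∘ suc)) ≡⟨ cong₂ _*_ (f≗g zero λ ())
                                        (product-scale-at a x y (λ s a≢s → f≗g (suc s) (a≢s ∘ Finₚ.suc-injective)) xfa≡yga) ⟩
  g zero * (y * product (g ∘ suc)) ≡⟨ x*[y*z]≡y*[x*z] (g zero) y _ ⟩
  y * (g zero * product (g ∘ suc)) ∎
  where open ≡-Reasoning

δ≤ : ∀ {r} (a s : Fin r) {t : Fin r → ℕ} → 1 ≤ t a → δ a s ≤ t s
δ≤ a s 1≤ta with a Finₚ.≟ s
... | yes refl = 1≤ta
... | no _     = z≤n

-- Pascal's rule suits the inductive counting below better than the closed form of _C_.
binom : ℕ → ℕ → ℕ
binom m       zero    = 1
binom zero    (suc t) = 0
binom (suc m) (suc t) = binom m t + binom m (suc t)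

binom≡C : ∀ m t → binom m t ≡ m C t
binom≡C m       zero    = refl
binom≡C zero    (suc t) = refl
binom≡C (suc m) (suc t) =
  trans (cong₂ _+_ (binom≡C m t) (binom≡C m (suc t))) (nCk+nC[k+1]≡[n+1]C[k+1] m t)

binom-absorb : ∀ m t → suc t * binom (suc m) (suc t) ≡ suc m * binom m t
binom-absorb zero    zero    = refl
binom-absorb zero    (suc t) = *-zeroʳ (suc (suc t))
binom-absorb (suc m) zero    = cong suc (binom-absorb m zero)
binom-absorb (suc m) (suc t) = begin
  suc (suc t) * (binom (suc m) (suc t) + binom (suc m) (suc (suc t)))
    ≡⟨ *-distribˡ-+ (suc (suc t)) (binom (suc m) (suc t)) _ ⟩
  binom (suc m) (suc t) + suc t * binom (suc m) (suc t) + suc (suc t) * binom (suc m) (suc (suc t))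
    ≡⟨ cong₂ (λ x y → binom (suc m) (suc t) + x + y) (binom-absorb m t) (binom-absorb m (suc t)) ⟩
  binom (suc m) (suc t) + suc m * binom m t + suc m * binom m (suc t)
    ≡⟨ +-assoc (binom (suc m) (suc t)) _ _ ⟩
  binom (suc m) (suc t) + (suc m * binom m t + suc m * binom m (suc t))
    ≡⟨ cong (binom (suc m) (suc t) +_) (*-distribˡ-+ (suc m) (binom m t) _) ⟨
  suc (suc m) * binom (suc m) (suc t) ∎
  where open ≡-Reasoning

falling : ℕ → ℕ → ℕ
falling m       zero    = 1
falling zero    (suc t) = 0
falling (suc m) (suc t) = suc m * falling m t

!*binom≡falling : ∀ m t → t ! * binom m t ≡ falling m t
!*binom≡falling m       zero    = refl
!*binom≡falling zero    (suc t) = *-zeroʳ (suc t !)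
!*binom≡falling (suc m) (suc t) = begin
  suc t * t ! * binom (suc m) (suc t)   ≡⟨ x*y*z≡y*[x*z] (suc t) (t !) _ ⟩
  t ! * (suc t * binom (suc m) (suc t)) ≡⟨ cong (t ! *_) (binom-absorb m t) ⟩
  t ! * (suc m * binom m t)             ≡⟨ x*[y*z]≡y*[x*z] (t !) (suc m) _ ⟩
  suc m * (t ! * binom m t)             ≡⟨ cong (suc m *_) (!*binom≡falling m t) ⟩
  suc m * falling m t                   ∎
  where
  open ≡-Reasoning
  x*y*z≡y*[x*z] : ∀ x y z → x * y * z ≡ y * (x * z)
  x*y*z≡y*[x*z] = solve-∀

falling≤^ : ∀ m t → falling m t ≤ m ^ t
falling≤^ m       zero    = ≤-refl
falling≤^ zero    (suc t) = z≤n
falling≤^ (suc m) (suc t) =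
  *-monoʳ-≤ (suc m) (≤-trans (falling≤^ m t) (^-monoˡ-≤ t (n≤1+n m)))

[1+m∸t]^t≤falling : ∀ m t → (suc m ∸ t) ^ t ≤ falling m t
[1+m∸t]^t≤falling m       zero    = ≤-refl
[1+m∸t]^t≤falling zero    (suc t) = ≤-reflexive (cong (_^ suc t) (0∸n≡0 t))
[1+m∸t]^t≤falling (suc m) (suc t) = *-mono-≤ (m∸n≤m (suc m) t) ([1+m∸t]^t≤falling m t)

falling*!≡! : ∀ a b → falling (a + b) a * b ! ≡ (a + b) !
falling*!≡! zero    b = +-identityʳ (b !)
falling*!≡! (suc a) b = trans (*-assoc (suc (a + b)) (falling (a + b) a) (b !))
  (cong (suc (a + b) *_) (falling*!≡! a b))

!≡!*!*binom : ∀ a b → (a + b) ! ≡ a ! * b ! * binom (a + b) a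
!≡!*!*binom a b = begin
  (a + b) !                           ≡⟨ falling*!≡! a b ⟨
  falling (a + b) a * b !             ≡⟨ cong (_* b !) (!*binom≡falling (a + b) a) ⟨
  a ! * binom (a + b) a * b !         ≡⟨ x*y*z≡x*z*y (a !) (binom (a + b) a) (b !) ⟩
  a ! * b ! * binom (a + b) a         ∎
  where
  open ≡-Reasoning
  x*y*z≡x*z*y : ∀ x y z → x * y * z ≡ x * z * y
  x*y*z≡x*z*y = solve-∀

multinomialℕ : ∀ {r} → (Fin r → ℕ) → ℕ
multinomialℕ {zero}  t = 1
multinomialℕ {suc r} t = binom (sum t) (t zero) * multinomialℕ (t ∘ suc)

sum!≡product!*multinomial : ∀ {r} (t : Fin r → ℕ) → sum t ! ≡ product (λ s → t s !) * multinomialℕ t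
sum!≡product!*multinomial {zero}  t = refl
sum!≡product!*multinomial {suc r} t = begin
  (t zero + sum (t ∘ suc)) !
    ≡⟨ !≡!*!*binom (t zero) (sum (t ∘ suc)) ⟩
  t zero ! * sum (t ∘ suc) ! * binom (sum t) (t zero)
    ≡⟨ cong (λ x → t zero ! * x * binom (sum t) (t zero)) (sum!≡product!*multinomial (t ∘ suc)) ⟩
  t zero ! * (product (λ s → t (suc s) !) * multinomialℕ (t ∘ suc)) * binom (sum t) (t zero)
    ≡⟨ rearrange (t zero !) (product (λ s → t (suc s) !)) (multinomialℕ (t ∘ suc)) _ ⟩
  t zero ! * product (λ s → t (suc s) !) * (binom (sum t) (t zero) * multinomialℕ (t ∘ suc)) ∎
  where
  open ≡-Reasoning
  rearrange : ∀ x y z w → x * (y * z) * w ≡ x * y * (w * z)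
  rearrange = solve-∀

[1+m]*[1+t]!*binom≡[1+t]*falling : ∀ m t → suc m * (suc t ! * binom m t) ≡ suc t * falling (suc m) (suc t)
[1+m]*[1+t]!*binom≡[1+t]*falling m t = begin
  suc m * (suc t * t ! * binom m t)   ≡⟨ rearrange (suc m) (suc t) (t !) (binom m t) ⟩
  suc t * (suc m * (t ! * binom m t)) ≡⟨ cong (λ x → suc t * (suc m * x)) (!*binom≡falling m t) ⟩
  suc t * falling (suc m) (suc t)     ∎
  where
  open ≡-Reasoning
  rearrange : ∀ a b c d → a * (b * c * d) ≡ b * (a * (c * d))
  rearrange = solve-∀

binom-zero : ∀ t → ¬ 0 ≡ t → binom 0 t ≡ 0
binom-zero zero    0≢0 = contradiction refl 0≢0
binom-zero (suc t) _   = refl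

∑ˢ : ∀ {N} → (Subset N → ℕ) → ℕ
∑ˢ {zero}  f = f []
∑ˢ {suc N} f = ∑ˢ (f ∘ (true ∷_)) + ∑ˢ (f ∘ (false ∷_))

∑ˢ-cong : ∀ {N} {f g : Subset N → ℕ} → (∀ e → f e ≡ g e) → ∑ˢ f ≡ ∑ˢ g
∑ˢ-cong {zero}  f≗g = f≗g []
∑ˢ-cong {suc N} f≗g = cong₂ _+_ (∑ˢ-cong (f≗g ∘ (true ∷_))) (∑ˢ-cong (f≗g ∘ (false ∷_)))

∑ˢ-mono-≤ : ∀ {N} {f g : Subset N → ℕ} → (∀ e → f e ≤ g e) → ∑ˢ f ≤ ∑ˢ g
∑ˢ-mono-≤ {zero}  f≤g = f≤g []
∑ˢ-mono-≤ {suc N} f≤g = +-mono-≤ (∑ˢ-mono-≤ (f≤g ∘ (true ∷_))) (∑ˢ-mono-≤ (f≤g ∘ (false ∷_)))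

∑ˢ-zero : ∀ N → ∑ˢ {N} (λ _ → 0) ≡ 0
∑ˢ-zero zero    = refl
∑ˢ-zero (suc N) = cong₂ _+_ (∑ˢ-zero N) (∑ˢ-zero N)

∑ˢ-sum : ∀ {N r} (g : Subset N → Fin r → ℕ) → ∑ˢ (λ e → sum (g e)) ≡ sum (λ l → ∑ˢ (λ e → g e l))
∑ˢ-sum {zero}  g = refl
∑ˢ-sum {suc N} g = trans (cong₂ _+_ (∑ˢ-sum (g ∘ (true ∷_))) (∑ˢ-sum (g ∘ (false ∷_))))
  (sym (∑-distrib-+ (λ l → ∑ˢ (λ e → g (true ∷ e) l)) (λ l → ∑ˢ (λ e → g (false ∷ e) l))))

sum-allSubsets≡∑ˢ : ∀ {N} (f : Subset N → ℕ) → sumₗ (List.map f (allSubsets N)) ≡ ∑ˢ f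
sum-allSubsets≡∑ˢ {zero}  f = +-identityʳ (f [])
sum-allSubsets≡∑ˢ {suc N} f = begin
  sumₗ (List.map f (List.map (true ∷_) A List.++ List.map (false ∷_) A))
    ≡⟨ cong sumₗ (Listₚ.map-++ f (List.map (true ∷_) A) _) ⟩
  sumₗ (List.map f (List.map (true ∷_) A) List.++ List.map f (List.map (false ∷_) A))
    ≡⟨ sum-++ (List.map f (List.map (true ∷_) A)) _ ⟩
  sumₗ (List.map f (List.map (true ∷_) A)) + sumₗ (List.map f (List.map (false ∷_) A))
    ≡⟨ cong₂ _+_ (cong sumₗ (Listₚ.map-∘ A)) (cong sumₗ (Listₚ.map-∘ A)) ⟨
  sumₗ (List.map (f ∘ (true ∷_)) A) + sumₗ (List.map (f ∘ (false ∷_)) A)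
    ≡⟨ cong₂ _+_ (sum-allSubsets≡∑ˢ (f ∘ (true ∷_))) (sum-allSubsets≡∑ˢ (f ∘ (false ∷_))) ⟩
  ∑ˢ f ∎
  where
  open ≡-Reasoning
  A = allSubsets N

partSize : ∀ {r N} → (Fin N → Fin r) → Fin r → ℕ
partSize p s = ∣ partSet p s ∣

typeOf : ∀ {r N} → (Fin N → Fin r) → Subset N → Fin r → ℕ
typeOf p e s = ∣ e ∩ partSet p s ∣

∣x∷e∣ : ∀ {N} x (e : Subset N) → ∣ x ∷ e ∣ ≡ (if x then 1 else 0) + ∣ e ∣
∣x∷e∣ true  e = refl
∣x∷e∣ false e = refl

∣isYes∷e∣ : ∀ {N} {A : Set} (a? : Dec A) (e : Subset N) → ∣ isYes a? ∷ e ∣ ≡ 𝟙 a? + ∣ e ∣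
∣isYes∷e∣ a? e = trans (∣x∷e∣ (isYes a?) e) (cong (λ b → (if b then 1 else 0) + ∣ e ∣) (isYes≗does a?))

partSize-suc : ∀ {r N} (p : Fin (suc N) → Fin r) s → partSize p s ≡ δ (p zero) s + partSize (p ∘ suc) s
partSize-suc p s = ∣isYes∷e∣ (p zero Finₚ.≟ s) (partSet (p ∘ suc) s)

typeOf-∷true : ∀ {r N} (p : Fin (suc N) → Fin r) e s → typeOf p (true ∷ e) s ≡ δ (p zero) s + typeOf (p ∘ suc) e s
typeOf-∷true p e s = ∣isYes∷e∣ (p zero Finₚ.≟ s) (e ∩ partSet (p ∘ suc) s)

occurrences : ∀ {r N} → Vec (Fin r) N → Fin r → ℕ
occurrences []       s = 0
occurrences (x ∷ xs) s = δ x s + occurrences xs s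

partSize-lookup : ∀ {r N} (xs : Vec (Fin r) N) s → partSize (lookup xs) s ≡ occurrences xs s
partSize-lookup []       s = refl
partSize-lookup (x ∷ xs) s = trans (partSize-suc (lookup (x ∷ xs)) s) (cong (δ x s +_) (partSize-lookup xs s))

occurrences-++ : ∀ {r m n} (xs : Vec (Fin r) m) (ys : Vec (Fin r) n) s →
  occurrences (xs Vec.++ ys) s ≡ occurrences xs s + occurrences ys s
occurrences-++ []       ys s = refl
occurrences-++ (x ∷ xs) ys s = trans (cong (δ x s +_) (occurrences-++ xs ys s)) (sym (+-assoc (δ x s) _ _))

occurrences-replicate : ∀ {r} m (a : Fin r) s → occurrences (Vec.replicate m a) s ≡ m * δ a s
occurrences-replicate zero    a s = refl
occurrences-replicate (suc m) a s = cong (δ a s +_) (occurrences-replicate m a s)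

occurrences-map-suc : ∀ {r n} (xs : Vec (Fin r) n) s → occurrences (Vec.map suc xs) (suc s) ≡ occurrences xs s
occurrences-map-suc []       s = refl
occurrences-map-suc (x ∷ xs) s = cong (δ x s +_) (occurrences-map-suc xs s)

occurrences-map-suc-zero : ∀ {r n} (xs : Vec (Fin r) n) → occurrences (Vec.map suc xs) zero ≡ 0
occurrences-map-suc-zero []       = refl
occurrences-map-suc-zero (x ∷ xs) = occurrences-map-suc-zero xs

blocks : ∀ {r} (m : Fin r → ℕ) → Vec (Fin r) (sum m)
blocks {zero}  m = []
blocks {suc r} m = Vec.replicate (m zero) zero Vec.++ Vec.map suc (blocks (m ∘ suc))

occurrences-blocks : ∀ {r} (m : Fin r → ℕ) s → occurrences (blocks m) s ≡ m s
occurrences-blocks {suc r} m zero = begin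
  occurrences (Vec.replicate (m zero) zero Vec.++ Vec.map suc (blocks (m ∘ suc))) zero
    ≡⟨ occurrences-++ (Vec.replicate (m zero) zero) _ zero ⟩
  occurrences (Vec.replicate (m zero) zero) zero + occurrences (Vec.map suc (blocks (m ∘ suc))) zero
    ≡⟨ cong₂ _+_ (occurrences-replicate (m zero) zero zero) (occurrences-map-suc-zero (blocks (m ∘ suc))) ⟩
  m zero * 1 + 0
    ≡⟨ trans (+-identityʳ _) (*-identityʳ (m zero)) ⟩
  m zero ∎
  where open ≡-Reasoning
occurrences-blocks {suc r} m (suc s) = begin
  occurrences (Vec.replicate (m zero) zero Vec.++ Vec.map suc (blocks (m ∘ suc))) (suc s)
    ≡⟨ occurrences-++ (Vec.replicate (m zero) zero) _ (suc s) ⟩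
  occurrences (Vec.replicate (m zero) zero) (suc s) + occurrences (Vec.map suc (blocks (m ∘ suc))) (suc s)
    ≡⟨ cong₂ _+_ (occurrences-replicate (m zero) zero (suc s)) (occurrences-map-suc (blocks (m ∘ suc)) s) ⟩
  m zero * 0 + occurrences (blocks (m ∘ suc)) s
    ≡⟨ cong₂ _+_ (*-zeroʳ (m zero)) (occurrences-blocks (m ∘ suc) s) ⟩
  m (suc s) ∎
  where open ≡-Reasoning

partitionWithSizes : ∀ {r N} (m : Fin r → ℕ) → sum m ≡ N → Fin N → Fin r
partitionWithSizes {r} m ∑m≡N = lookup (subst (Vec (Fin r)) ∑m≡N (blocks m))

partSize-partitionWithSizes : ∀ {r N} (m : Fin r → ℕ) (∑m≡N : sum m ≡ N) s →
  partSize (partitionWithSizes m ∑m≡N) s ≡ m s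
partSize-partitionWithSizes m refl s = trans (partSize-lookup (blocks m) s) (occurrences-blocks m s)

inhabited-part : ∀ {r N} (p : Fin N → Fin r) s → 1 ≤ partSize p s → ∃[ v ] (p v ≡ s)
inhabited-part {N = suc N} p s 1≤size with p zero Finₚ.≟ s
... | yes p0≡s = zero , p0≡s
... | no p0≢s  with inhabited-part (p ∘ suc) s 1≤size
...   | v , pv≡s = suc v , pv≡s

-- The offset o records the part memberships of vertices already split off from e.
HasType : ∀ {r N} → (Fin N → Fin r) → (o t : Fin r → ℕ) → Subset N → Set
HasType p o t e = ∀ s → o s + typeOf p e s ≡ t s

hasType? : ∀ {r N} (p : Fin N → Fin r) o t → Decidable (HasType p o t)
hasType? p o t e = Finₚ.all? (λ s → o s + typeOf p e s ≟ t s)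

pointwise-⇔ : ∀ {r} {x y t u : Fin r → ℕ} →
  (∀ s → (x s ≡ t s) ⇔ (y s ≡ u s)) → (∀ s → x s ≡ t s) ⇔ (∀ s → y s ≡ u s)
pointwise-⇔ eq = mk⇔ (λ h s → Equivalence.to (eq s) (h s)) (λ h s → Equivalence.from (eq s) (h s))

HasType-∷true : ∀ {r N} (p : Fin (suc N) → Fin r) o t e →
  HasType p o t (true ∷ e) ⇔ HasType (p ∘ suc) (λ s → o s + δ (p zero) s) t e
HasType-∷true p o t e = pointwise-⇔ λ s →
  ≡-cong-⇔ (trans (cong (o s +_) (typeOf-∷true p e s)) (sym (+-assoc (o s) _ _))) refl

𝟙-hasType-∷true : ∀ {r N} (p : Fin (suc N) → Fin r) o t e →
  𝟙 (hasType? p o t (true ∷ e)) ≡ 𝟙 (hasType? (p ∘ suc) (λ s → o s + δ (p zero) s) t e)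
𝟙-hasType-∷true p o t e = 𝟙-⇔ (HasType-∷true p o t e) (hasType? p o t (true ∷ e)) (hasType? (p ∘ suc) _ t e)

countType : ∀ {r N} → (Fin N → Fin r) → (o t : Fin r → ℕ) → ℕ
countType p o t = ∑ˢ (𝟙 ∘ hasType? p o t)

countType∋ : ∀ {r N} → (Fin N → Fin r) → Fin N → (o t : Fin r → ℕ) → ℕ
countType∋ p v o t = ∑ˢ (λ e → if lookup e v then 𝟙 (hasType? p o t e) else 0)

countType-cong : ∀ {r N} (p : Fin N → Fin r) {o o′ t t′} →
  (∀ e → HasType p o t e ⇔ HasType p o′ t′ e) → countType p o t ≡ countType p o′ t′
countType-cong p {o} {o′} {t} {t′} eq = ∑ˢ-cong λ e → 𝟙-⇔ (eq e) (hasType? p o t e) (hasType? p o′ t′ e)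

countType∋-cong : ∀ {r N} (p : Fin N → Fin r) v {o o′ t t′} →
  (∀ e → HasType p o t e ⇔ HasType p o′ t′ e) → countType∋ p v o t ≡ countType∋ p v o′ t′
countType∋-cong p v {o} {o′} {t} {t′} eq =
  ∑ˢ-cong λ e → cong (if lookup e v then_else 0) (𝟙-⇔ (eq e) (hasType? p o t e) (hasType? p o′ t′ e))

countType-suc : ∀ {r N} (p : Fin (suc N) → Fin r) o t →
  countType p o t ≡ countType (p ∘ suc) (λ s → o s + δ (p zero) s) t + countType (p ∘ suc) o t
countType-suc p o t = cong (_+ countType (p ∘ suc) o t) (∑ˢ-cong λ e → 𝟙-hasType-∷true p o t e)

countType∋-zero : ∀ {r N} (p : Fin (suc N) → Fin r) o t →
  countType∋ p zero o t ≡ countType (p ∘ suc) (λ s → o s + δ (p zero) s) t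
countType∋-zero {N = N} p o t = trans
  (cong₂ _+_ (∑ˢ-cong λ e → 𝟙-hasType-∷true p o t e) (∑ˢ-zero N)) (+-identityʳ _)

countType∋-suc : ∀ {r N} (p : Fin (suc N) → Fin r) v o t →
  countType∋ p (suc v) o t ≡ countType∋ (p ∘ suc) v (λ s → o s + δ (p zero) s) t + countType∋ (p ∘ suc) v o t
countType∋-suc p v o t = cong (_+ countType∋ (p ∘ suc) v o t)
  (∑ˢ-cong λ e → cong (if lookup e v then_else 0) (𝟙-hasType-∷true p o t e))

-- Removing v is a bijection from the sets of type t + e_(p v) through v onto the sets of type t avoiding v.
countType∋-split : ∀ {r N} (p : Fin N → Fin r) v o t →
  countType∋ p v o t + countType∋ p v o (λ s → t s + δ (p v) s) ≡ countType p o t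
countType∋-split {N = suc N} p zero o t = begin
  countType∋ p zero o t + countType∋ p zero o t⁺
    ≡⟨ cong₂ _+_ (countType∋-zero p o t) (countType∋-zero p o t⁺) ⟩
  countType p′ o⁺ t + countType p′ o⁺ t⁺
    ≡⟨ cong (countType p′ o⁺ t +_) (countType-cong p′ λ e → pointwise-⇔ λ s → cancel (o s) (typeOf p′ e s) (t s)) ⟩
  countType p′ o⁺ t + countType p′ o t
    ≡⟨ countType-suc p o t ⟨
  countType p o t ∎
  where
  open ≡-Reasoning
  p′ = p ∘ suc
  o⁺ = λ s → o s + δ (p zero) s
  t⁺ = λ s → t s + δ (p zero) s
  cancel : ∀ x y z {d} → (x + d + y ≡ z + d) ⇔ (x + y ≡ z)
  cancel x y z {d} = mk⇔ (λ h → +-cancelʳ-≡ d (x + y) z (trans (+-comm (x + y) d) (trans (sym (x+d+y≡d+[x+y])) h)))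
                         (λ h → trans x+d+y≡d+[x+y] (trans (cong (d +_) h) (+-comm d z)))
    where
    x+d+y≡d+[x+y] : x + d + y ≡ d + (x + y)
    x+d+y≡d+[x+y] = trans (cong (_+ y) (+-comm x d)) (+-assoc d x y)
countType∋-split {N = suc N} p (suc v) o t = begin
  countType∋ p (suc v) o t + countType∋ p (suc v) o t⁺
    ≡⟨ cong₂ _+_ (countType∋-suc p v o t) (countType∋-suc p v o t⁺) ⟩
  (countType∋ p′ v o⁺ t + countType∋ p′ v o t) + (countType∋ p′ v o⁺ t⁺ + countType∋ p′ v o t⁺)
    ≡⟨ interchange (countType∋ p′ v o⁺ t) _ _ _ ⟩
  (countType∋ p′ v o⁺ t + countType∋ p′ v o⁺ t⁺) + (countType∋ p′ v o t + countType∋ p′ v o t⁺)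
    ≡⟨ cong₂ _+_ (countType∋-split p′ v o⁺ t) (countType∋-split p′ v o t) ⟩
  countType p′ o⁺ t + countType p′ o t
    ≡⟨ countType-suc p o t ⟨
  countType p o t ∎
  where
  open ≡-Reasoning
  p′ = p ∘ suc
  o⁺ = λ s → o s + δ (p zero) s
  t⁺ = λ s → t s + δ (p (suc v)) s

product-binom-stay : ∀ {r} (a : Fin r) (m t : Fin r → ℕ) → t a ≡ 0 →
  product (λ s → binom (δ a s + m s) (t s)) ≡ product (λ s → binom (m s) (t s))
product-binom-stay a m t ta≡0 = product-cong-≗ λ s → stay s
  where
  stay : ∀ s → binom (δ a s + m s) (t s) ≡ binom (m s) (t s)
  stay s with a Finₚ.≟ s
  ... | yes refl = trans (cong (binom _) ta≡0) (cong (binom _) (sym ta≡0))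
  ... | no _     = refl

product-binom-pascal : ∀ {r} (a : Fin r) (m t : Fin r → ℕ) {u} → t a ≡ suc u →
  product (λ s → binom (δ a s + m s) (t s)) ≡ product (λ s → binom (m s) (t s ∸ δ a s)) + product (λ s → binom (m s) (t s))
product-binom-pascal a m t {u} ta≡1+u = product-linear-at a
  (λ s a≢s → trans (cong (λ y → binom (m s) (t s ∸ y)) (δ-off a≢s)) (cong (λ x → binom (x + m s) (t s)) (sym (δ-off a≢s))))
  (λ s a≢s → cong (λ x → binom (x + m s) (t s)) (sym (δ-off a≢s)))
  (begin
    binom (δ a a + m a) (t a)                 ≡⟨ cong₂ (λ x y → binom (x + m a) y) (δ-diag a) ta≡1+u ⟩
    binom (m a) u + binom (m a) (suc u)       ≡⟨ cong (λ x → binom (m a) (x ∸ 1) + binom (m a) x) ta≡1+u ⟨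
    binom (m a) (t a ∸ 1) + binom (m a) (t a) ≡⟨ cong (λ x → binom (m a) (t a ∸ x) + binom (m a) (t a)) (δ-diag a) ⟨
    binom (m a) (t a ∸ δ a a) + binom (m a) (t a) ∎)
  where open ≡-Reasoning

countType≡0 : ∀ {r N} (p : Fin N → Fin r) o t → (∀ e → ¬ HasType p o t e) → countType p o t ≡ 0
countType≡0 {N = N} p o t none = trans (∑ˢ-cong λ e → 𝟙-no (hasType? p o t e) (none e)) (∑ˢ-zero N)

countType≡product-binom : ∀ {r N} (p : Fin N → Fin r) t →
  countType p (λ _ → 0) t ≡ product (λ s → binom (partSize p s) (t s))
countType≡product-binom {r} {zero} p t = count (hasType? p (λ _ → 0) t [])
  where
  count : (d : Dec (∀ s → 0 ≡ t s)) → 𝟙 d ≡ product (λ s → binom 0 (t s))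
  count d@(yes t≡0) = trans (𝟙-yes d t≡0)
    (sym (trans (product-cong-≗ λ s → cong (binom 0) (sym (t≡0 s))) (product-replicate-one r)))
  count d@(no t≢0) with Finₚ.¬∀⟶∃¬ _ _ (λ s → 0 ≟ t s) t≢0
  ... | s , 0≢ts = trans (𝟙-no d t≢0) (sym (product-zero _ s (binom-zero (t s) 0≢ts)))
countType≡product-binom {N = suc N} p t with t (p zero) in ta
... | zero = begin
  countType p (λ _ → 0) t                                  ≡⟨ countType-suc p (λ _ → 0) t ⟩
  countType p′ (δ a) t + countType p′ (λ _ → 0) t          ≡⟨ cong (_+ countType p′ (λ _ → 0) t) (countType≡0 p′ (δ a) t none) ⟩
  countType p′ (λ _ → 0) t                                 ≡⟨ countType≡product-binom p′ t ⟩
  product (λ s → binom (partSize p′ s) (t s))              ≡⟨ product-binom-stay a (partSize p′) t ta ⟨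
  product (λ s → binom (δ a s + partSize p′ s) (t s))      ≡⟨ product-cong-≗ (λ s → cong (λ x → binom x (t s)) (partSize-suc p s)) ⟨
  product (λ s → binom (partSize p s) (t s))               ∎
  where
  open ≡-Reasoning
  a = p zero
  p′ = p ∘ suc
  none : ∀ e → ¬ HasType p′ (δ a) t e
  none e has = 1+n≢0 (trans (cong (_+ typeOf p′ e a) (sym (δ-diag a))) (trans (has a) ta))
... | suc u = begin
  countType p (λ _ → 0) t
    ≡⟨ countType-suc p (λ _ → 0) t ⟩
  countType p′ (δ a) t + countType p′ (λ _ → 0) t
    ≡⟨ cong (_+ countType p′ (λ _ → 0) t) (countType-cong p′ λ e → pointwise-⇔ λ s → m+n≡o⇔n≡o∸m (δ≤ a s 1≤ta)) ⟩
  countType p′ (λ _ → 0) t⁻ + countType p′ (λ _ → 0) t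
    ≡⟨ cong₂ _+_ (countType≡product-binom p′ t⁻) (countType≡product-binom p′ t) ⟩
  product (λ s → binom (partSize p′ s) (t⁻ s)) + product (λ s → binom (partSize p′ s) (t s))
    ≡⟨ product-binom-pascal a (partSize p′) t ta ⟨
  product (λ s → binom (δ a s + partSize p′ s) (t s))
    ≡⟨ product-cong-≗ (λ s → cong (λ x → binom x (t s)) (partSize-suc p s)) ⟨
  product (λ s → binom (partSize p s) (t s)) ∎
  where
  open ≡-Reasoning
  a = p zero
  p′ = p ∘ suc
  t⁻ = λ s → t s ∸ δ a s
  1≤ta : 1 ≤ t a
  1≤ta = subst (1 ≤_) (sym ta) (s≤s z≤n)

1≤typeOf : ∀ {r N} (p : Fin N → Fin r) e v → lookup e v ≡ true → 1 ≤ typeOf p e (p v)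
1≤typeOf p (true ∷ e) zero _ = ≤-trans (≤-reflexive (sym (δ-diag (p zero))))
  (≤-trans (m≤m+n _ _) (≤-reflexive (sym (typeOf-∷true p e (p zero)))))
1≤typeOf p (true ∷ e) (suc v) ev = ≤-trans (1≤typeOf (p ∘ suc) e v ev)
  (≤-trans (m≤n+m _ _) (≤-reflexive (sym (typeOf-∷true p e (p (suc v))))))
1≤typeOf p (false ∷ e) (suc v) ev = 1≤typeOf (p ∘ suc) e v ev

1≤partSize : ∀ {r N} (p : Fin N → Fin r) v → 1 ≤ partSize p (p v)
1≤partSize p zero = ≤-trans (≤-reflexive (sym (δ-diag (p zero))))
  (≤-trans (m≤m+n _ _) (≤-reflexive (sym (partSize-suc p (p zero)))))
1≤partSize p (suc v) = ≤-trans (1≤partSize (p ∘ suc) v)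
  (≤-trans (m≤n+m _ _) (≤-reflexive (sym (partSize-suc p (p (suc v))))))

countType∋≡0 : ∀ {r N} (p : Fin N → Fin r) v t → t (p v) ≡ 0 → countType∋ p v (λ _ → 0) t ≡ 0
countType∋≡0 {N = N} p v t ti≡0 = trans (∑ˢ-cong term≡0) (∑ˢ-zero N)
  where
  term≡0 : ∀ e → (if lookup e v then 𝟙 (hasType? p (λ _ → 0) t e) else 0) ≡ 0
  term≡0 e with lookup e v in ev
  ... | true  = 𝟙-no (hasType? p (λ _ → 0) t e)
                  λ has → <⇒≢ (1≤typeOf p e v ev) (sym (trans (has (p v)) ti≡0))
  ... | false = refl

countType∋≡product-binom : ∀ {r N} (p : Fin N → Fin r) v (m : Fin r → ℕ) →
  (∀ s → partSize p s ≡ δ (p v) s + m s) → ∀ u (t : Fin r → ℕ) → t (p v) ≡ u →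
  countType∋ p v (λ _ → 0) (λ s → t s + δ (p v) s) ≡ product (λ s → binom (m s) (t s))
countType∋≡product-binom p v m size zero t ti≡0 = begin
  countType∋ p v o t⁺                                ≡⟨ cong (_+ countType∋ p v o t⁺) (countType∋≡0 p v t ti≡0) ⟨
  countType∋ p v o t + countType∋ p v o t⁺           ≡⟨ countType∋-split p v o t ⟩
  countType p o t                                    ≡⟨ countType≡product-binom p t ⟩
  product (λ s → binom (partSize p s) (t s))         ≡⟨ product-cong-≗ (λ s → cong (λ x → binom x (t s)) (size s)) ⟩
  product (λ s → binom (δ (p v) s + m s) (t s))      ≡⟨ product-binom-stay (p v) m t ti≡0 ⟩
  product (λ s → binom (m s) (t s))                  ∎
  where
  open ≡-Reasoning
  o : Fin _ → ℕ
  o _ = 0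
  t⁺ = λ s → t s + δ (p v) s
countType∋≡product-binom p v m size (suc w) t ti≡1+w = +-cancelˡ-≡ (product (λ s → binom (m s) (t⁻ s))) _ _ (begin
  product (λ s → binom (m s) (t⁻ s)) + countType∋ p v o t⁺
    ≡⟨ cong (_+ countType∋ p v o t⁺) through⁻ ⟨
  countType∋ p v o t + countType∋ p v o t⁺
    ≡⟨ countType∋-split p v o t ⟩
  countType p o t
    ≡⟨ countType≡product-binom p t ⟩
  product (λ s → binom (partSize p s) (t s))
    ≡⟨ product-cong-≗ (λ s → cong (λ x → binom x (t s)) (size s)) ⟩
  product (λ s → binom (δ (p v) s + m s) (t s))
    ≡⟨ product-binom-pascal (p v) m t ti≡1+w ⟩
  product (λ s → binom (m s) (t⁻ s)) + product (λ s → binom (m s) (t s)) ∎)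
  where
  open ≡-Reasoning
  o : Fin _ → ℕ
  o _ = 0
  t⁺ = λ s → t s + δ (p v) s
  t⁻ = λ s → t s ∸ δ (p v) s
  through⁻ : countType∋ p v o t ≡ product (λ s → binom (m s) (t⁻ s))
  through⁻ = trans
    (countType∋-cong p v λ e → pointwise-⇔ λ s →
      ≡-cong-⇔ refl (sym (m∸n+n≡m (δ≤ (p v) s (subst (1 ≤_) (sym ti≡1+w) (s≤s z≤n))))))
    (countType∋≡product-binom p v m size w t⁻ (cong₂ _∸_ ti≡1+w (δ-diag (p v))))

countType∋-falling : ∀ {r N} (p : Fin N → Fin r) v t →
  partSize p (p v) * product (λ s → t s !) * countType∋ p v (λ _ → 0) t ≡
  t (p v) * product (λ s → falling (partSize p s) (t s))
countType∋-falling p v t with t (p v) in ti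
... | zero  = trans (cong (partSize p (p v) * product (λ s → t s !) *_) (countType∋≡0 p v t ti))
                    (*-zeroʳ (partSize p (p v) * product (λ s → t s !)))
... | suc u = begin
  m i * product (λ s → t s !) * countType∋ p v (λ _ → 0) t
    ≡⟨ cong (m i * product (λ s → t s !) *_) through ⟩
  m i * product (λ s → t s !) * product (λ s → binom (m⁻ s) (t⁻ s))
    ≡⟨ *-assoc (m i) _ _ ⟩
  m i * (product (λ s → t s !) * product (λ s → binom (m⁻ s) (t⁻ s)))
    ≡⟨ cong (m i *_) (product-distrib-* (λ s → t s !) _) ⟨
  m i * product (λ s → t s ! * binom (m⁻ s) (t⁻ s))
    ≡⟨ product-scale-at i (m i) (suc u) off at ⟩
  suc u * product (λ s → falling (m s) (t s)) ∎
  where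
  open ≡-Reasoning
  i = p v
  m = partSize p
  m⁻ = λ s → m s ∸ δ i s
  t⁻ = λ s → t s ∸ δ i s
  1≤ti : 1 ≤ t i
  1≤ti = subst (1 ≤_) (sym ti) (s≤s z≤n)
  through : countType∋ p v (λ _ → 0) t ≡ product (λ s → binom (m⁻ s) (t⁻ s))
  through = trans
    (countType∋-cong p v λ e → pointwise-⇔ λ s → ≡-cong-⇔ refl (sym (m∸n+n≡m (δ≤ i s 1≤ti))))
    (countType∋≡product-binom p v m⁻ (λ s → sym (m+[n∸m]≡n (δ≤ i s (1≤partSize p v)))) u t⁻ (cong₂ _∸_ ti (δ-diag i)))
  off : ∀ s → ¬ i ≡ s → t s ! * binom (m⁻ s) (t⁻ s) ≡ falling (m s) (t s)
  off s i≢s rewrite δ-off i≢s = !*binom≡falling (m s) (t s)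
  diag : ∀ M → 1 ≤ M → M * (suc u ! * binom (M ∸ 1) u) ≡ suc u * falling M (suc u)
  diag (suc M) _ = [1+m]*[1+t]!*binom≡[1+t]*falling M u
  at : m i * (t i ! * binom (m⁻ i) (t⁻ i)) ≡ suc u * falling (m i) (t i)
  at rewrite δ-diag i | ti = diag (m i) (1≤partSize p v)

countType∋-multinomial : ∀ {r N} (p : Fin N → Fin r) v t →
  partSize p (p v) * sum t ! * countType∋ p v (λ _ → 0) t ≡
  t (p v) * product (λ s → falling (partSize p s) (t s)) * multinomialℕ t
countType∋-multinomial p v t = begin
  mᵢ * sum t ! * C                                   ≡⟨ cong (λ x → mᵢ * x * C) (sum!≡product!*multinomial t) ⟩
  mᵢ * (product (λ s → t s !) * multinomialℕ t) * C  ≡⟨ rearrange mᵢ (product (λ s → t s !)) (multinomialℕ t) C ⟩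
  mᵢ * product (λ s → t s !) * C * multinomialℕ t    ≡⟨ cong (_* multinomialℕ t) (countType∋-falling p v t) ⟩
  t (p v) * product (λ s → falling (partSize p s) (t s)) * multinomialℕ t ∎
  where
  open ≡-Reasoning
  mᵢ = partSize p (p v)
  C = countType∋ p v (λ _ → 0) t
  rearrange : ∀ a b c d → a * (b * c) * d ≡ a * b * d * c
  rearrange = solve-∀

degree≡∑ˢ : ∀ {k r N} (H : ColKGraph k r N) v →
  degree H v ≡ ∑ˢ (λ e → if isEdge H e then (if lookup e v then 1 else 0) else 0)
degree≡∑ˢ {N = N} H v = trans (sym (Listₚ.foldr-map _+_ edge∋ 0 (allSubsets N))) (sum-allSubsets≡∑ˢ edge∋)
  where
  edge∋ : Subset N → ℕ
  edge∋ e = if isEdge H e then (if lookup e v then 1 else 0) else 0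

∣e∣≡sum-typeOf : ∀ {r N} (p : Fin N → Fin r) (e : Subset N) → ∣ e ∣ ≡ sum (typeOf p e)
∣e∣≡sum-typeOf {r} p []          = sym (sum-replicate-zero r)
∣e∣≡sum-typeOf {r} p (true ∷ e)  = begin
  suc ∣ e ∣                                           ≡⟨ cong suc (∣e∣≡sum-typeOf (p ∘ suc) e) ⟩
  suc (sum (typeOf (p ∘ suc) e))                      ≡⟨ cong (_+ sum (typeOf (p ∘ suc) e)) (sum-δ (p zero)) ⟨
  sum (δ (p zero)) + sum (typeOf (p ∘ suc) e)         ≡⟨ ∑-distrib-+ (δ (p zero)) (typeOf (p ∘ suc) e) ⟨
  sum (λ s → δ (p zero) s + typeOf (p ∘ suc) e s)     ≡⟨ sum-cong-≗ (typeOf-∷true p e) ⟨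
  sum (typeOf p (true ∷ e))                           ∎
  where open ≡-Reasoning
∣e∣≡sum-typeOf     p (false ∷ e) = ∣e∣≡sum-typeOf (p ∘ suc) e

typeDegree : ∀ {r N} → (Fin N → Fin r) → Fin N → (Fin r → Fin r → ℕ) → ℕ
typeDegree p v T = sum (λ l → countType∋ p v (λ _ → 0) (T l))

allowedType∋ : ∀ {r N} → (Fin N → Fin r) → Fin N → (Fin r → Fin r → ℕ) → Subset N → Fin r → ℕ
allowedType∋ p v T e l = if lookup e v then 𝟙 (hasType? p (λ _ → 0) (T l) e) else 0

typeDegree≡∑ˢ : ∀ {r N} (p : Fin N → Fin r) v T → typeDegree p v T ≡ ∑ˢ (λ e → sum (allowedType∋ p v T e))
typeDegree≡∑ˢ p v T = sym (∑ˢ-sum (allowedType∋ p v T))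

degree≤typeDegree : ∀ {k r N} (H : ColKGraph k r N) (p : Fin N → Fin r) (T : Fin r → Fin r → ℕ) →
  (∀ e c → colour H e ≡ just c → ∀ s → typeOf p e s ≡ T c s) → ∀ v → degree H v ≤ typeDegree p v T
degree≤typeDegree H p T typed v = begin
  degree H v                                                   ≡⟨ degree≡∑ˢ H v ⟩
  ∑ˢ (λ e → if isEdge H e then (if lookup e v then 1 else 0) else 0) ≤⟨ ∑ˢ-mono-≤ edge≤ ⟩
  ∑ˢ (λ e → sum (allowedType∋ p v T e))                        ≡⟨ typeDegree≡∑ˢ p v T ⟨
  typeDegree p v T                                             ∎
  where
  open ≤-Reasoning
  edge≤ : ∀ e → (if isEdge H e then (if lookup e v then 1 else 0) else 0) ≤ sum (allowedType∋ p v T e)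
  edge≤ e with colour H e in ce
  ... | nothing = z≤n
  ... | just c  = ≤-trans (≤-reflexive (cong (if lookup e v then_else 0)
                                                (sym (𝟙-yes (hasType? p (λ _ → 0) (T c) e) (typed e c ce)))))
                          (≤-sum (allowedType∋ p v T e) c)

colourByType : ∀ {r N} → (Fin N → Fin r) → (Fin r → Fin r → ℕ) → Subset N → Maybe (Fin r)
colourByType p T e with Finₚ.any? (λ l → hasType? p (λ _ → 0) (T l) e)
... | yes (l , _) = just l
... | no _        = nothing

colourByType-just : ∀ {r N} (p : Fin N → Fin r) T e {c} → colourByType p T e ≡ just c → HasType p (λ _ → 0) (T c) e
colourByType-just p T e eq with Finₚ.any? (λ l → hasType? p (λ _ → 0) (T l) e)
colourByType-just p T e refl | yes (_ , has) = has

colourByType-nothing : ∀ {r N} (p : Fin N → Fin r) T e → colourByType p T e ≡ nothing → ∀ l → ¬ HasType p (λ _ → 0) (T l) e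
colourByType-nothing p T e eq l has with Finₚ.any? (λ l → hasType? p (λ _ → 0) (T l) e)
colourByType-nothing p T e eq   l has | no none = none (l , has)

canonicalGraph : ∀ {k r N} (p : Fin N → Fin r) (T : Fin r → Fin r → ℕ) → (∀ l → sum (T l) ≡ k) → ColKGraph k r N
canonicalGraph p T ∣T∣≡k = record
  { colour  = colourByType p T
  ; uniform = λ e c eq → trans (∣e∣≡sum-typeOf p e) (trans (sum-cong-≗ (colourByType-just p T e eq)) (∣T∣≡k c))
  }

sum-𝟙≤1 : ∀ {r} {P : Fin r → Set} (P? : Decidable P) → (∀ x y → P x → P y → x ≡ y) → sum (λ l → 𝟙 (P? l)) ≤ 1
sum-𝟙≤1 {zero}  P? unique = z≤n
sum-𝟙≤1 {suc r} P? unique with P? zero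
... | yes P0 = ≤-reflexive (cong suc (trans
                 (sum-cong-≗ λ l → 𝟙-no (P? (suc l)) λ Pl → Finₚ.0≢1+n (unique zero (suc l) P0 Pl))
                 (sum-replicate-zero r)))
... | no _   = sum-𝟙≤1 (P? ∘ suc) λ x y Px Py → Finₚ.suc-injective (unique (suc x) (suc y) Px Py)

typeDegree≤degree : ∀ {k r N} (p : Fin N → Fin r) (T : Fin r → Fin r → ℕ) (∣T∣≡k : ∀ l → sum (T l) ≡ k) →
  (∀ x y → (∀ s → T x s ≡ T y s) → x ≡ y) → ∀ v → typeDegree p v T ≤ degree (canonicalGraph p T ∣T∣≡k) v
typeDegree≤degree {r = r} p T ∣T∣≡k T-injective v = begin
  typeDegree p v T                                                       ≡⟨ typeDegree≡∑ˢ p v T ⟩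
  ∑ˢ (λ e → sum (allowedType∋ p v T e))                                  ≤⟨ ∑ˢ-mono-≤ ≤edge ⟩
  ∑ˢ (λ e → if isEdge H e then (if lookup e v then 1 else 0) else 0)     ≡⟨ degree≡∑ˢ H v ⟨
  degree H v                                                             ∎
  where
  open ≤-Reasoning
  H = canonicalGraph p T ∣T∣≡k
  ≤edge : ∀ e → sum (λ l → if lookup e v then 𝟙 (hasType? p (λ _ → 0) (T l) e) else 0) ≤
                (if isEdge H e then (if lookup e v then 1 else 0) else 0)
  ≤edge e with lookup e v | colourByType p T e in ce
  ... | false | _      = ≤-trans (≤-reflexive (sum-replicate-zero r)) z≤n
  ... | true  | just c  = sum-𝟙≤1 (λ l → hasType? p (λ _ → 0) (T l) e)
        λ x y Tx Ty → T-injective x y λ s → trans (sym (Tx s)) (Ty s)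
  ... | true  | nothing = ≤-reflexive
        (trans (sum-cong-≗ λ l → 𝟙-no (hasType? p (λ _ → 0) (T l) e) (colourByType-nothing p T e ce l)) (sum-replicate-zero r))

[y+a]^[1+d]≤y^[1+d]+[1+d]*a*[y+a]^d : ∀ y a d → (y + a) ^ suc d ≤ y ^ suc d + suc d * a * (y + a) ^ d
[y+a]^[1+d]≤y^[1+d]+[1+d]*a*[y+a]^d y a zero = ≤-reflexive (lemma y a)
  where
  lemma : ∀ y a → (y + a) * 1 ≡ y * 1 + (a + 0) * 1
  lemma = solve-∀
[y+a]^[1+d]≤y^[1+d]+[1+d]*a*[y+a]^d y a (suc d) = begin
  (y + a) * (y + a) ^ suc d
    ≡⟨ *-distribʳ-+ ((y + a) ^ suc d) y a ⟩
  y * (y + a) ^ suc d + a * (y + a) ^ suc d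
    ≤⟨ +-monoˡ-≤ (a * (y + a) ^ suc d) (*-monoʳ-≤ y ([y+a]^[1+d]≤y^[1+d]+[1+d]*a*[y+a]^d y a d)) ⟩
  y * (y ^ suc d + suc d * a * (y + a) ^ d) + a * (y + a) ^ suc d
    ≡⟨ expand y (y ^ suc d) (suc d * a) ((y + a) ^ d) (a * (y + a) ^ suc d) ⟩
  y * y ^ suc d + suc d * a * (y * (y + a) ^ d) + a * (y + a) ^ suc d
    ≤⟨ +-monoˡ-≤ (a * (y + a) ^ suc d) (+-monoʳ-≤ (y * y ^ suc d)
         (*-monoʳ-≤ (suc d * a) (*-monoˡ-≤ ((y + a) ^ d) (m≤m+n y a)))) ⟩
  y * y ^ suc d + suc d * a * ((y + a) * (y + a) ^ d) + a * (y + a) ^ suc d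
    ≡⟨ collect (y * y ^ suc d) d a ((y + a) * (y + a) ^ d) ⟩
  y * y ^ suc d + suc (suc d) * a * ((y + a) * (y + a) ^ d) ∎
  where
  open ≤-Reasoning
  expand : ∀ y Y k X Z → y * (Y + k * X) + Z ≡ y * Y + k * (y * X) + Z
  expand = solve-∀
  collect : ∀ W d a X → W + suc d * a * X + a * X ≡ W + suc (suc d) * a * X
  collect = solve-∀

-- ((y + 1) / y)^(1+d) ≤ 1 + B / Y with denominators cleared.
Y*[1+y]^[1+d]≤[Y+B]*y^[1+d] : ∀ Y B y d → (Y + B) * suc d ≤ B * (y + 1) →
  Y * (y + 1) ^ suc d ≤ (Y + B) * y ^ suc d
Y*[1+y]^[1+d]≤[Y+B]*y^[1+d] Y B y d hyp = +-cancelʳ-≤ (B * x ^ suc d) (Y * x ^ suc d) ((Y + B) * y ^ suc d) (begin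
  Y * x ^ suc d + B * x ^ suc d             ≡⟨ *-distribʳ-+ (x ^ suc d) Y B ⟨
  (Y + B) * x ^ suc d                       ≤⟨ *-monoʳ-≤ (Y + B) ([y+a]^[1+d]≤y^[1+d]+[1+d]*a*[y+a]^d y 1 d) ⟩
  (Y + B) * (y ^ suc d + suc d * 1 * x ^ d) ≡⟨ expand (Y + B) (y ^ suc d) (suc d) (x ^ d) ⟩
  (Y + B) * y ^ suc d + (Y + B) * suc d * x ^ d ≤⟨ +-monoʳ-≤ ((Y + B) * y ^ suc d) (*-monoˡ-≤ (x ^ d) hyp) ⟩
  (Y + B) * y ^ suc d + B * x * x ^ d       ≡⟨ cong ((Y + B) * y ^ suc d +_) (*-assoc B x (x ^ d)) ⟩
  (Y + B) * y ^ suc d + B * x ^ suc d       ∎)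
  where
  open ≤-Reasoning
  x = y + 1
  expand : ∀ Z a b c → Z * (a + b * 1 * c) ≡ Z * a + Z * b * c
  expand = solve-∀

product-falling≤ : ∀ {r} (c : Fin r → ℕ) n t →
  product (λ s → falling (c s * n) (t s)) ≤ n ^ sum t * product (λ s → c s ^ t s)
product-falling≤ c n t = begin
  product (λ s → falling (c s * n) (t s))         ≤⟨ product-mono-≤ (λ s → falling≤^ (c s * n) (t s)) ⟩
  product (λ s → (c s * n) ^ t s)                 ≡⟨ product-cong-≗ (λ s → ^-distribʳ-* (c s) n (t s)) ⟩
  product (λ s → c s ^ t s * n ^ t s)             ≡⟨ product-distrib-* (λ s → c s ^ t s) _ ⟩
  product (λ s → c s ^ t s) * product (λ s → n ^ t s) ≡⟨ cong (product (λ s → c s ^ t s) *_) (product-^ n t) ⟩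
  product (λ s → c s ^ t s) * n ^ sum t           ≡⟨ *-comm (product (λ s → c s ^ t s)) _ ⟩
  n ^ sum t * product (λ s → c s ^ t s)           ∎
  where open ≤-Reasoning

≤product-falling : ∀ {r} (c : Fin r → ℕ) n k t → (∀ s → 1 ≤ c s) → (∀ s → t s ≤ k) →
  (n ∸ k) ^ sum t * product (λ s → c s ^ t s) ≤ product (λ s → falling (c s * n) (t s))
≤product-falling c n k t 1≤c t≤k = begin
  (n ∸ k) ^ sum t * product (λ s → c s ^ t s)             ≡⟨ *-comm ((n ∸ k) ^ sum t) _ ⟩
  product (λ s → c s ^ t s) * (n ∸ k) ^ sum t             ≡⟨ cong (product (λ s → c s ^ t s) *_) (product-^ (n ∸ k) t) ⟨
  product (λ s → c s ^ t s) * product (λ s → (n ∸ k) ^ t s) ≡⟨ product-distrib-* (λ s → c s ^ t s) _ ⟨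
  product (λ s → c s ^ t s * (n ∸ k) ^ t s)               ≡⟨ product-cong-≗ (λ s → ^-distribʳ-* (c s) (n ∸ k) (t s)) ⟨
  product (λ s → (c s * (n ∸ k)) ^ t s)                   ≤⟨ product-mono-≤ (λ s → ^-monoˡ-≤ (t s) (c[n∸k]≤1+cn∸t s)) ⟩
  product (λ s → (suc (c s * n) ∸ t s) ^ t s)             ≤⟨ product-mono-≤ (λ s → [1+m∸t]^t≤falling (c s * n) (t s)) ⟩
  product (λ s → falling (c s * n) (t s))                 ∎
  where
  open ≤-Reasoning
  c[n∸k]≤1+cn∸t : ∀ s → c s * (n ∸ k) ≤ suc (c s * n) ∸ t s
  c[n∸k]≤1+cn∸t s = begin
    c s * (n ∸ k)     ≡⟨ *-distribˡ-∸ (c s) n k ⟩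
    c s * n ∸ c s * k ≤⟨ ∸-monoʳ-≤ (c s * n) (*-monoˡ-≤ k (1≤c s)) ⟩
    c s * n ∸ 1 * k   ≤⟨ ∸-mono (n≤1+n (c s * n)) (≤-trans (t≤k s) (≤-reflexive (sym (*-identityˡ k)))) ⟩
    suc (c s * n) ∸ t s ∎

-- The numerator of the i-th term of the minimum, for c s = r j_s + σ and T ℓ = j + σ e_ℓ;
-- the denominator is k^k r^(k-1) c i.
numerator : ∀ {r} → (Fin r → ℕ) → (Fin r → Fin r → ℕ) → Fin r → ℕ
numerator c T i = sum (λ l → T l i * multinomialℕ (T l) * product (λ s → c s ^ T l s))

typeDegree≤ : ∀ {r N} (p : Fin N → Fin r) v (c : Fin r → ℕ) n k (T : Fin r → Fin r → ℕ) →
  (∀ s → partSize p s ≡ c s * n) → (∀ l → sum (T l) ≡ k) →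
  c (p v) * n * k ! * typeDegree p v T ≤ n ^ k * numerator c T (p v)
typeDegree≤ p v c n k T size ∣T∣≡k = begin
  c i * n * k ! * typeDegree p v T
    ≡⟨ *-distribˡ-sum (c i * n * k !) (λ l → countType∋ p v (λ _ → 0) (T l)) ⟩
  sum (λ l → c i * n * k ! * countType∋ p v (λ _ → 0) (T l))
    ≤⟨ sum-mono-≤ bound ⟩
  sum (λ l → n ^ k * (T l i * multinomialℕ (T l) * product (λ s → c s ^ T l s)))
    ≡⟨ *-distribˡ-sum (n ^ k) (λ l → T l i * multinomialℕ (T l) * product (λ s → c s ^ T l s)) ⟨
  n ^ k * numerator c T i ∎
  where
  open ≤-Reasoning
  i = p v
  rearrange : ∀ t M P Q → t * (Q * P) * M ≡ Q * (t * M * P)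
  rearrange = solve-∀
  bound : ∀ l → c i * n * k ! * countType∋ p v (λ _ → 0) (T l) ≤
                n ^ k * (T l i * multinomialℕ (T l) * product (λ s → c s ^ T l s))
  bound l = begin
    c i * n * k ! * countType∋ p v (λ _ → 0) (T l)
      ≡⟨ cong (λ x → x * countType∋ p v (λ _ → 0) (T l)) (cong₂ (λ x y → x * y !) (sym (size i)) (sym (∣T∣≡k l))) ⟩
    partSize p i * sum (T l) ! * countType∋ p v (λ _ → 0) (T l)
      ≡⟨ countType∋-multinomial p v (T l) ⟩
    T l i * product (λ s → falling (partSize p s) (T l s)) * multinomialℕ (T l)
      ≡⟨ cong (λ x → T l i * x * multinomialℕ (T l)) (product-cong-≗ λ s → cong (λ x → falling x (T l s)) (size s)) ⟩
    T l i * product (λ s → falling (c s * n) (T l s)) * multinomialℕ (T l)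
      ≤⟨ *-monoˡ-≤ (multinomialℕ (T l)) (*-monoʳ-≤ (T l i) (product-falling≤ c n (T l))) ⟩
    T l i * (n ^ sum (T l) * product (λ s → c s ^ T l s)) * multinomialℕ (T l)
      ≡⟨ cong (λ x → T l i * (n ^ x * product (λ s → c s ^ T l s)) * multinomialℕ (T l)) (∣T∣≡k l) ⟩
    T l i * (n ^ k * product (λ s → c s ^ T l s)) * multinomialℕ (T l)
      ≡⟨ rearrange (T l i) (multinomialℕ (T l)) (product (λ s → c s ^ T l s)) (n ^ k) ⟩
    n ^ k * (T l i * multinomialℕ (T l) * product (λ s → c s ^ T l s)) ∎

≤typeDegree : ∀ {r N} (p : Fin N → Fin r) v (c : Fin r → ℕ) n k (T : Fin r → Fin r → ℕ) →
  (∀ s → partSize p s ≡ c s * n) → (∀ l → sum (T l) ≡ k) → (∀ s → 1 ≤ c s) →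
  (n ∸ k) ^ k * numerator c T (p v) ≤ c (p v) * n * k ! * typeDegree p v T
≤typeDegree p v c n k T size ∣T∣≡k 1≤c = begin
  (n ∸ k) ^ k * numerator c T i
    ≡⟨ *-distribˡ-sum ((n ∸ k) ^ k) (λ l → T l i * multinomialℕ (T l) * product (λ s → c s ^ T l s)) ⟩
  sum (λ l → (n ∸ k) ^ k * (T l i * multinomialℕ (T l) * product (λ s → c s ^ T l s)))
    ≤⟨ sum-mono-≤ bound ⟩
  sum (λ l → c i * n * k ! * countType∋ p v (λ _ → 0) (T l))
    ≡⟨ *-distribˡ-sum (c i * n * k !) (λ l → countType∋ p v (λ _ → 0) (T l)) ⟨
  c i * n * k ! * typeDegree p v T ∎
  where
  open ≤-Reasoning
  i = p v
  rearrange : ∀ t M P Q → Q * (t * M * P) ≡ t * (Q * P) * M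
  rearrange = solve-∀
  T≤k : ∀ l s → T l s ≤ k
  T≤k l s = subst (T l s ≤_) (∣T∣≡k l) (≤-sum (T l) s)
  bound : ∀ l → (n ∸ k) ^ k * (T l i * multinomialℕ (T l) * product (λ s → c s ^ T l s)) ≤
                c i * n * k ! * countType∋ p v (λ _ → 0) (T l)
  bound l = begin
    (n ∸ k) ^ k * (T l i * multinomialℕ (T l) * product (λ s → c s ^ T l s))
      ≡⟨ rearrange (T l i) (multinomialℕ (T l)) (product (λ s → c s ^ T l s)) ((n ∸ k) ^ k) ⟩
    T l i * ((n ∸ k) ^ k * product (λ s → c s ^ T l s)) * multinomialℕ (T l)
      ≡⟨ cong (λ x → T l i * ((n ∸ k) ^ x * product (λ s → c s ^ T l s)) * multinomialℕ (T l)) (∣T∣≡k l) ⟨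
    T l i * ((n ∸ k) ^ sum (T l) * product (λ s → c s ^ T l s)) * multinomialℕ (T l)
      ≤⟨ *-monoˡ-≤ (multinomialℕ (T l)) (*-monoʳ-≤ (T l i) (≤product-falling c n k (T l) 1≤c (T≤k l))) ⟩
    T l i * product (λ s → falling (c s * n) (T l s)) * multinomialℕ (T l)
      ≡⟨ cong (λ x → T l i * x * multinomialℕ (T l)) (product-cong-≗ λ s → cong (λ x → falling x (T l s)) (size s)) ⟨
    T l i * product (λ s → falling (partSize p s) (T l s)) * multinomialℕ (T l)
      ≡⟨ countType∋-multinomial p v (T l) ⟨
    partSize p i * sum (T l) ! * countType∋ p v (λ _ → 0) (T l)
      ≡⟨ cong (λ x → x * countType∋ p v (λ _ → 0) (T l)) (cong₂ (λ x y → x * y !) (size i) (∣T∣≡k l)) ⟩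
    c i * n * k ! * countType∋ p v (λ _ → 0) (T l) ∎

[N∸1-d]^d≤d!*binom : ∀ N d → 1 ≤ N → (N ∸ suc d) ^ d ≤ d ! * binom (N ∸ 1) d
[N∸1-d]^d≤d!*binom (suc N) d _ = begin
  (N ∸ d) ^ d            ≤⟨ ^-monoˡ-≤ d (∸-monoˡ-≤ d (n≤1+n N)) ⟩
  (suc N ∸ d) ^ d        ≤⟨ [1+m∸t]^t≤falling N d ⟩
  falling N d            ≡⟨ !*binom≡falling N d ⟨
  d ! * binom N d        ∎
  where open ≤-Reasoning

d!*binom≤N^d : ∀ N d → d ! * binom (N ∸ 1) d ≤ N ^ d
d!*binom≤N^d N d = begin
  d ! * binom (N ∸ 1) d  ≡⟨ !*binom≡falling (N ∸ 1) d ⟩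
  falling (N ∸ 1) d      ≤⟨ falling≤^ (N ∸ 1) d ⟩
  (N ∸ 1) ^ d            ≤⟨ ^-monoˡ-≤ d (m∸n≤m N 1) ⟩
  N ^ d                  ∎
  where open ≤-Reasoning

k*r*n∸k≡k*[r*n∸1] : ∀ k r n → k * r * n ∸ k ≡ k * (r * n ∸ 1)
k*r*n∸k≡k*[r*n∸1] k r n = trans (cong₂ _∸_ (*-assoc k r n) (sym (*-identityʳ k))) (sym (*-distribˡ-∸ k (r * n) 1))

-- δ / C ≤ X / B + 1 / q with denominators cleared, where C = binom (N ∸ 1) d for N = k r n, and
-- B = k^k r^d c is the denominator of the term.
upper-estimate : ∀ d r n q c X D δ C → 1 ≤ d → 1 ≤ r → 1 ≤ n → 1 ≤ c →
  c * n * suc d ! * D ≤ n ^ suc d * X →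
  (suc d * r * n ∸ suc d) ^ d ≤ d ! * C →
  (X * q + suc d ^ suc d * r ^ d * c) * d ≤ n →
  δ ≤ D →
  δ * (suc d ^ suc d * r ^ d * c) * q ≤ (X * q + suc d ^ suc d * r ^ d * c) * C
upper-estimate (suc d′) r n q c X D δ C _ 1≤r 1≤n 1≤c D≤ [N∸k]^d≤ small δ≤D =
  *-cancelˡ-≤ W {{>-nonZero (*-mono-≤ 1≤n (1≤n! k))}} (begin
    W * (δ * B * q)                             ≤⟨ *-monoʳ-≤ W (*-monoˡ-≤ q (*-monoˡ-≤ B δ≤D)) ⟩
    W * (D * B * q)                             ≡⟨ rearrange₁ n (k !) D K₀ c q ⟩
    c * n * k ! * D * (K₀ * q)                  ≤⟨ *-monoˡ-≤ (K₀ * q) D≤ ⟩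
    n * n ^ d * X * (k ^ k * r ^ d * q)         ≡⟨ rearrange₂ n (n ^ d) X (k ^ k) (r ^ d) q ⟩
    n * k ^ k * (X * q * (r ^ d * n ^ d))       ≡⟨ cong (λ z → n * k ^ k * (X * q * z)) (^-distribʳ-* r n d) ⟨
    n * k ^ k * (X * q * (r * n) ^ d)           ≡⟨ cong (λ z → n * k ^ k * (X * q * z ^ d)) rn≡y+1 ⟩
    n * k ^ k * (X * q * (y + 1) ^ d)           ≤⟨ *-monoʳ-≤ (n * k ^ k) (Y*[1+y]^[1+d]≤[Y+B]*y^[1+d] (X * q) B y d′ small′) ⟩
    n * k ^ k * ((X * q + B) * y ^ d)           ≡⟨ rearrange₃ n k (k ^ d) (X * q + B) (y ^ d) ⟩
    (X * q + B) * n * k * (k ^ d * y ^ d)       ≡⟨ cong ((X * q + B) * n * k *_) (^-distribʳ-* k y d) ⟨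
    (X * q + B) * n * k * (k * y) ^ d           ≡⟨ cong (λ z → (X * q + B) * n * k * z ^ d) (k*r*n∸k≡k*[r*n∸1] k r n) ⟨
    (X * q + B) * n * k * (k * r * n ∸ k) ^ d   ≤⟨ *-monoʳ-≤ ((X * q + B) * n * k) [N∸k]^d≤ ⟩
    (X * q + B) * n * k * (d ! * C)             ≡⟨ rearrange₄ (X * q + B) n k (d !) C ⟩
    W * ((X * q + B) * C)                       ∎)
  where
  open ≤-Reasoning
  d = suc d′
  k = suc d
  K₀ = k ^ k * r ^ d
  B = K₀ * c
  W = n * k !
  y = r * n ∸ 1
  rn≡y+1 : r * n ≡ y + 1
  rn≡y+1 = sym (m∸n+n≡m (*-mono-≤ 1≤r 1≤n))
  small′ : (X * q + B) * d ≤ B * (y + 1)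
  small′ = begin
    (X * q + B) * d ≤⟨ small ⟩
    n               ≤⟨ m≤n*m n r {{>-nonZero 1≤r}} ⟩
    r * n           ≤⟨ m≤n*m (r * n) B {{>-nonZero (*-mono-≤ (*-mono-≤ (1≤m^n k (s≤s z≤n)) (1≤m^n d 1≤r)) 1≤c)}} ⟩
    B * (r * n)     ≡⟨ cong (B *_) rn≡y+1 ⟩
    B * (y + 1)     ∎
  rearrange₁ : ∀ n f D K₀ c q → n * f * (D * (K₀ * c) * q) ≡ c * n * f * D * (K₀ * q)
  rearrange₁ = solve-∀
  rearrange₂ : ∀ n nd X kk rd q → n * nd * X * (kk * rd * q) ≡ n * kk * (X * q * (rd * nd))
  rearrange₂ = solve-∀
  rearrange₃ : ∀ n k kd Z yd → n * (k * kd) * (Z * yd) ≡ Z * n * k * (kd * yd)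
  rearrange₃ = solve-∀
  rearrange₄ : ∀ Z n k f C → Z * n * k * (f * C) ≡ n * (k * f) * (Z * C)
  rearrange₄ = solve-∀

-- X / B - 1 / q ≤ D / C with denominators cleared.
lower-estimate : ∀ d r n q c X D C → 1 ≤ n → 1 ≤ c → suc d ≤ n →
  (n ∸ suc d) ^ suc d * X ≤ c * n * suc d ! * D →
  (suc d * r * n ∸ suc d) ^ d ≤ d ! * C →
  d ! * C ≤ (suc d * r * n) ^ d →
  X * q * suc d ≤ n →
  n ≤ suc d * r * n ∸ suc d →
  X * q * C ≤ D * (suc d ^ suc d * r ^ d * c) * q + (suc d ^ suc d * r ^ d * c) * C
lower-estimate d r n q c X D C 1≤n 1≤c k≤n ≤D [N∸k]^d≤ ≤N^d small n≤N∸k =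
  *-cancelˡ-≤ W {{>-nonZero (*-mono-≤ 1≤n (1≤n! k))}} (begin
    W * (X * q * C)                                     ≡⟨ rearrange₁ n k (d !) X q C ⟩
    X * q * n * k * (d ! * C)                           ≤⟨ *-monoʳ-≤ (X * q * n * k) ≤N^d ⟩
    X * q * n * k * (k * r * n) ^ d                     ≡⟨ cong (X * q * n * k *_)
                                                             (trans (^-distribʳ-* (k * r) n d) (cong (_* n ^ d) (^-distribʳ-* k r d))) ⟩
    X * q * n * k * (k ^ d * r ^ d * n ^ d)             ≡⟨ rearrange₂ X q n k (k ^ d) (r ^ d) (n ^ d) ⟩
    K₀ * (Y * n ^ k)                                    ≤⟨ *-monoʳ-≤ K₀ Yn^k≤ ⟩
    K₀ * (Y * (n ∸ k) ^ k + c * n * k * Z ^ d)          ≡⟨ rearrange₃ K₀ X q ((n ∸ k) ^ k) c n k (Z ^ d) ⟩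
    (n ∸ k) ^ k * X * (K₀ * q) + K₀ * c * n * k * Z ^ d ≤⟨ +-mono-≤ (*-monoˡ-≤ (K₀ * q) ≤D) (*-monoʳ-≤ (K₀ * c * n * k) [N∸k]^d≤) ⟩
    c * n * k ! * D * (K₀ * q) + K₀ * c * n * k * (d ! * C) ≡⟨ rearrange₄ c n k (d !) D K₀ q C ⟩
    W * (D * B * q + B * C)                             ∎)
  where
  open ≤-Reasoning
  k = suc d
  K₀ = k ^ k * r ^ d
  B = K₀ * c
  W = n * k !
  Y = X * q
  Z = k * r * n ∸ k
  rearrange₁ : ∀ n k f X q C → n * (k * f) * (X * q * C) ≡ X * q * n * k * (f * C)
  rearrange₁ = solve-∀
  rearrange₂ : ∀ X q n k kd rd nd → X * q * n * k * (kd * rd * nd) ≡ k * kd * rd * (X * q * (n * nd))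
  rearrange₂ = solve-∀
  rearrange₃ : ∀ K₀ X q a c n k z → K₀ * (X * q * a + c * n * k * z) ≡ a * X * (K₀ * q) + K₀ * c * n * k * z
  rearrange₃ = solve-∀
  rearrange₄ : ∀ c n k f D K₀ q C →
    c * n * (k * f) * D * (K₀ * q) + K₀ * c * n * k * (f * C) ≡ n * (k * f) * (D * (K₀ * c) * q + K₀ * c * C)
  rearrange₄ = solve-∀
  n≡[n∸k]+k : n ≡ (n ∸ k) + k
  n≡[n∸k]+k = sym (m∸n+n≡m k≤n)
  Yn^k≤ : Y * n ^ k ≤ Y * (n ∸ k) ^ k + c * n * k * Z ^ d
  Yn^k≤ = begin
    Y * n ^ k                                       ≡⟨ cong (λ z → Y * z ^ k) n≡[n∸k]+k ⟩
    Y * ((n ∸ k) + k) ^ k                           ≤⟨ *-monoʳ-≤ Y ([y+a]^[1+d]≤y^[1+d]+[1+d]*a*[y+a]^d (n ∸ k) k d) ⟩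
    Y * ((n ∸ k) ^ k + k * k * ((n ∸ k) + k) ^ d)   ≡⟨ cong (λ z → Y * ((n ∸ k) ^ k + k * k * z ^ d)) n≡[n∸k]+k ⟨
    Y * ((n ∸ k) ^ k + k * k * n ^ d)               ≡⟨ expand Y ((n ∸ k) ^ k) k (n ^ d) ⟩
    Y * (n ∸ k) ^ k + k * (Y * k) * n ^ d           ≤⟨ +-monoʳ-≤ (Y * (n ∸ k) ^ k) (*-mono-≤ (*-monoʳ-≤ k small) (^-monoˡ-≤ d n≤N∸k)) ⟩
    Y * (n ∸ k) ^ k + k * n * Z ^ d                 ≤⟨ +-monoʳ-≤ (Y * (n ∸ k) ^ k) (*-monoˡ-≤ (Z ^ d)
                                                         (≤-trans (≤-reflexive (*-comm k n)) (*-monoˡ-≤ k (m≤n*m n c {{>-nonZero 1≤c}})))) ⟩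
    Y * (n ∸ k) ^ k + c * n * k * Z ^ d             ∎
    where
    expand : ∀ Y a k b → Y * (a + k * k * b) ≡ Y * a + k * (Y * k) * b
    expand = solve-∀

-- When |V(H)| = k r n, the part V_s has partWeight r j σ s · n vertices.
partWeight : ∀ r → (Fin r → ℕ) → Sign → Fin r → ℕ
partWeight r j σ s = ℤ.∣ rjσ r j σ s ∣

colourType : ∀ {r} → (Fin r → ℕ) → Sign → Fin r → Fin r → ℕ
colourType j σ l s = ℤ.∣ jls j σ l s ∣

module _ {k r : ℕ} (j : Fin r → ℕ) where

  1≤j : Valid k r j minus → ∀ s → 1 ≤ j s
  1≤j valid s with j s | proj₂ valid s
  ... | suc _ | _ = s≤s z≤n

  ∑j-plus : Valid k r j plus → suc (sum j) ≡ k
  ∑j-plus valid = ℤₚ.+-injective (trans (cong (λ x → ℤ.+ suc x) (sym (sumFinℕ≡sum r j))) (proj₁ valid))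

  ∑j-minus : Valid k r j minus → sum j ≡ suc k
  ∑j-minus valid = lemma (sum j) (trans (cong (λ x → ℤ.-[1+ 0 ] ℤ.+ ℤ.+ x) (sym (sumFinℕ≡sum r j))) (proj₁ valid))
    where
    lemma : ∀ x → ℤ.-[1+ 0 ] ℤ.+ ℤ.+ x ≡ ℤ.+ k → x ≡ suc k
    lemma (suc x) eq = cong suc (ℤₚ.+-injective eq)

  colourType-plus : ∀ l s → colourType j plus l s ≡ j s + δ l s
  colourType-plus l s with l Finₚ.≟ s
  ... | yes refl = refl
  ... | no _     = sym (+-identityʳ (j s))

  colourType-minus : Valid k r j minus → ∀ l s → colourType j minus l s ≡ j s ∸ δ l s
  colourType-minus valid l s with l Finₚ.≟ s
  ... | yes refl = cong ℤ.∣_∣ (ℤₚ.⊖-≥ (1≤j valid l))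
  ... | no _     = refl

  jls≡colourType : ∀ σ → Valid k r j σ → ∀ l s → jls j σ l s ≡ ℤ.+ colourType j σ l s
  jls≡colourType σ valid l s with l Finₚ.≟ s
  ... | yes refl = sym (ℤₚ.0≤i⇒+∣i∣≡i (proj₂ valid l))
  ... | no _     = refl

  rjσ≡partWeight : ∀ σ → 1 ≤ r → Valid k r j σ → ∀ s → rjσ r j σ s ≡ ℤ.+ partWeight r j σ s
  rjσ≡partWeight plus  1≤r valid s = refl
  rjσ≡partWeight minus 1≤r valid s = trans (ℤₚ.⊖-≥ 1≤rj) (cong ℤ.+_ (sym (cong ℤ.∣_∣ (ℤₚ.⊖-≥ 1≤rj))))
    where
    1≤rj : 1 ≤ r * j s
    1≤rj = *-mono-≤ 1≤r (1≤j valid s)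

  sum-colourType : ∀ σ → Valid k r j σ → ∀ l → sum (colourType j σ l) ≡ k
  sum-colourType plus valid l = begin
    sum (colourType j plus l)         ≡⟨ sum-cong-≗ (colourType-plus l) ⟩
    sum (λ s → j s + δ l s)           ≡⟨ ∑-distrib-+ j (δ l) ⟩
    sum j + sum (δ l)                 ≡⟨ cong (sum j +_) (sum-δ l) ⟩
    sum j + 1                         ≡⟨ +-comm (sum j) 1 ⟩
    suc (sum j)                       ≡⟨ ∑j-plus valid ⟩
    k                                 ∎
    where open ≡-Reasoning
  sum-colourType minus valid l = suc-injective (begin
    suc (sum (colourType j minus l))  ≡⟨ +-comm 1 _ ⟩
    sum (colourType j minus l) + 1    ≡⟨ cong₂ _+_ (sum-cong-≗ (colourType-minus valid l)) (sym (sum-δ l)) ⟩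
    sum (λ s → j s ∸ δ l s) + sum (δ l) ≡⟨ ∑-distrib-+ (λ s → j s ∸ δ l s) (δ l) ⟨
    sum (λ s → j s ∸ δ l s + δ l s)   ≡⟨ sum-cong-≗ (λ s → m∸n+n≡m (δ≤ l s (1≤j valid l))) ⟩
    sum j                             ≡⟨ ∑j-minus valid ⟩
    suc k                             ∎)
    where open ≡-Reasoning

  sum-partWeight : ∀ σ → 1 ≤ r → Valid k r j σ → sum (partWeight r j σ) ≡ k * r
  sum-partWeight plus 1≤r valid = begin
    sum (λ s → r * j s + 1)           ≡⟨ ∑-distrib-+ (λ s → r * j s) (λ _ → 1) ⟩
    sum (λ s → r * j s) + sum {r} (λ _ → 1) ≡⟨ cong₂ _+_ (sym (*-distribˡ-sum r j)) (sum-const r 1) ⟩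
    r * sum j + r * 1                 ≡⟨ cong₂ _+_ (*-comm r (sum j)) (*-identityʳ r) ⟩
    sum j * r + r                     ≡⟨ +-comm (sum j * r) r ⟩
    suc (sum j) * r                   ≡⟨ cong (_* r) (∑j-plus valid) ⟩
    k * r                             ∎
    where open ≡-Reasoning
  sum-partWeight minus 1≤r valid = +-cancelʳ-≡ r _ _ (begin
    sum (partWeight r j minus) + r    ≡⟨ cong₂ _+_ (sum-cong-≗ λ s → cong ℤ.∣_∣ (ℤₚ.⊖-≥ (1≤rj s)))
                                                   (trans (sym (*-identityʳ r)) (sym (sum-const r 1))) ⟩
    sum (λ s → r * j s ∸ 1) + sum {r} (λ _ → 1) ≡⟨ ∑-distrib-+ (λ s → r * j s ∸ 1) (λ _ → 1) ⟨
    sum (λ s → r * j s ∸ 1 + 1)       ≡⟨ sum-cong-≗ (λ s → m∸n+n≡m (1≤rj s)) ⟩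
    sum (λ s → r * j s)               ≡⟨ *-distribˡ-sum r j ⟨
    r * sum j                         ≡⟨ cong (r *_) (∑j-minus valid) ⟩
    r * suc k                         ≡⟨ *-comm r (suc k) ⟩
    r + k * r                         ≡⟨ +-comm r (k * r) ⟩
    k * r + r                         ∎)
    where
    open ≡-Reasoning
    1≤rj : ∀ s → 1 ≤ r * j s
    1≤rj s = *-mono-≤ 1≤r (1≤j valid s)

  1≤partWeight : ∀ σ → 2 ≤ r → Valid k r j σ → ∀ s → 1 ≤ partWeight r j σ s
  1≤partWeight plus  2≤r valid s = m≤n+m 1 _
  1≤partWeight minus 2≤r valid s = subst (1 ≤_) (sym (cong ℤ.∣_∣ (ℤₚ.⊖-≥ (≤-trans (s≤s z≤n) 2≤rj))))
    (∸-monoˡ-≤ 1 2≤rj)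
    where
    2≤rj : 2 ≤ r * j s
    2≤rj = *-mono-≤ 2≤r (1≤j valid s)

  colourType-injective : ∀ σ → Valid k r j σ → ∀ x y → (∀ s → colourType j σ x s ≡ colourType j σ y s) → x ≡ y
  colourType-injective σ valid x y same with x Finₚ.≟ y
  ... | yes x≡y = x≡y
  ... | no x≢y  = contradiction (same x) (differ σ valid)
    where
    differ : ∀ σ → Valid k r j σ → ¬ colourType j σ x x ≡ colourType j σ y x
    differ plus _ eq = 1+n≢0 (+-cancelˡ-≡ (j x) 1 0 (begin
      j x + 1             ≡⟨ cong (j x +_) (δ-diag x) ⟨
      j x + δ x x         ≡⟨ sym (colourType-plus x x) ⟩
      colourType j plus x x ≡⟨ eq ⟩
      colourType j plus y x ≡⟨ colourType-plus y x ⟩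
      j x + δ y x         ≡⟨ cong (j x +_) (δ-off (x≢y ∘ sym)) ⟩
      j x + 0             ∎))
      where open ≡-Reasoning
    differ minus valid eq = 1+n≢n (sym (begin
      j x ∸ 1             ≡⟨ cong (j x ∸_) (δ-diag x) ⟨
      j x ∸ δ x x         ≡⟨ sym (colourType-minus valid x x) ⟩
      colourType j minus x x ≡⟨ eq ⟩
      colourType j minus y x ≡⟨ colourType-minus valid y x ⟩
      j x ∸ δ y x         ≡⟨ cong (j x ∸_) (δ-off (x≢y ∘ sym)) ⟩
      j x                 ≡⟨ m∸n+n≡m (1≤j valid x) ⟨
      j x ∸ 1 + 1         ≡⟨ +-comm (j x ∸ 1) 1 ⟩
      suc (j x ∸ 1)       ∎))
      where open ≡-Reasoning

toℚᵘ-ℤ→ℚ : ∀ z → ℚ.toℚᵘ (ℤ→ℚ z) ℚᵘ.≃ ℚᵘ.mkℚᵘ z 0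
toℚᵘ-ℤ→ℚ z = ℚₚ.toℚᵘ-fromℚᵘ (ℚᵘ.mkℚᵘ z 0)

ℤ→ℚ≡mkℚ : ∀ z → ℤ→ℚ z ≡ ℚ.mkℚ z 0 (Coprime.sym (Coprime.1-coprimeTo ℤ.∣ z ∣))
ℤ→ℚ≡mkℚ z = ℚₚ.fromℚᵘ-toℚᵘ (ℚ.mkℚ z 0 (Coprime.sym (Coprime.1-coprimeTo ℤ.∣ z ∣)))

ℕ→ℚ-+ : ∀ a b → ℕ→ℚ (a + b) ≡ ℕ→ℚ a ℚ.+ ℕ→ℚ b
ℕ→ℚ-+ a b = ℚₚ.toℚᵘ-injective (ℚᵘₚ.≃-sym (ℚᵘₚ.≃-trans (ℚₚ.toℚᵘ-homo-+ (ℕ→ℚ a) (ℕ→ℚ b))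
  (ℚᵘₚ.≃-trans (ℚᵘₚ.+-cong (toℚᵘ-ℤ→ℚ (ℤ.+ a)) (toℚᵘ-ℤ→ℚ (ℤ.+ b)))
    (ℚᵘₚ.≃-trans (ℚᵘ.*≡* eq) (ℚᵘₚ.≃-sym (toℚᵘ-ℤ→ℚ (ℤ.+ (a + b))))))))
  where
  eq : ((ℤ.+ a ℤ.* ℤ.+ 1) ℤ.+ (ℤ.+ b ℤ.* ℤ.+ 1)) ℤ.* ℤ.+ 1 ≡ ℤ.+ (a + b) ℤ.* ℤ.+ (1 * 1)
  eq = trans (ℤₚ.*-identityʳ _) (trans (cong₂ ℤ._+_ (ℤₚ.*-identityʳ (ℤ.+ a)) (ℤₚ.*-identityʳ (ℤ.+ b))) (sym (ℤₚ.*-identityʳ _)))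

ℕ→ℚ-* : ∀ a b → ℕ→ℚ (a * b) ≡ ℕ→ℚ a ℚ.* ℕ→ℚ b
ℕ→ℚ-* a b = ℚₚ.toℚᵘ-injective (ℚᵘₚ.≃-sym (ℚᵘₚ.≃-trans (ℚₚ.toℚᵘ-homo-* (ℕ→ℚ a) (ℕ→ℚ b))
  (ℚᵘₚ.≃-trans (ℚᵘₚ.*-cong (toℚᵘ-ℤ→ℚ (ℤ.+ a)) (toℚᵘ-ℤ→ℚ (ℤ.+ b)))
    (ℚᵘₚ.≃-trans (ℚᵘ.*≡* eq) (ℚᵘₚ.≃-sym (toℚᵘ-ℤ→ℚ (ℤ.+ (a * b))))))))
  where
  eq : (ℤ.+ a ℤ.* ℤ.+ b) ℤ.* ℤ.+ 1 ≡ ℤ.+ (a * b) ℤ.* ℤ.+ (1 * 1)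
  eq = trans (ℤₚ.*-identityʳ _) (trans (sym (ℤₚ.pos-* a b)) (sym (ℤₚ.*-identityʳ _)))

ℕ→ℚ-injective : ∀ a b → ℕ→ℚ a ≡ ℕ→ℚ b → a ≡ b
ℕ→ℚ-injective a b eq with ℚᵘₚ.≃-trans (ℚᵘₚ.≃-sym (toℚᵘ-ℤ→ℚ (ℤ.+ a))) (ℚᵘₚ.≃-trans (ℚₚ.toℚᵘ-cong eq) (toℚᵘ-ℤ→ℚ (ℤ.+ b)))
... | ℚᵘ.*≡* e = ℤₚ.+-injective (trans (sym (ℤₚ.*-identityʳ (ℤ.+ a))) (trans e (ℤₚ.*-identityʳ (ℤ.+ b))))

÷'≡÷ : ∀ p q (q≢0 : ¬ q ≡ ℚ.0ℚ) → p ÷' q ≡ ℚ._÷_ p q {{ℚ.≢-nonZero q≢0}}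
÷'≡÷ p q q≢0 with q ℚₚ.≟ ℚ.0ℚ
... | yes q≡0 = contradiction q≡0 q≢0
... | no _    = refl

ℕ→ℚ[1+b]≢0 : ∀ b → ¬ ℕ→ℚ (suc b) ≡ ℚ.0ℚ
ℕ→ℚ[1+b]≢0 b eq = 1+n≢0 (ℕ→ℚ-injective (suc b) 0 eq)

ℕ→ℚ÷'ℕ→ℚ : ∀ a b → ℕ→ℚ a ÷' ℕ→ℚ (suc b) ≡ ℚ.fromℚᵘ (ℚᵘ.mkℚᵘ (ℤ.+ a) b)
ℕ→ℚ÷'ℕ→ℚ a b = trans (÷'≡÷ (ℕ→ℚ a) (ℕ→ℚ (suc b)) (ℕ→ℚ[1+b]≢0 b))
  (ℚₚ.toℚᵘ-injective (ℚᵘₚ.≃-trans toℚᵘ-÷ (ℚᵘₚ.≃-sym (ℚₚ.toℚᵘ-fromℚᵘ _))))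
  where
  instance
    _ = ℚ.≢-nonZero (ℕ→ℚ[1+b]≢0 b)
  toℚᵘ-1/ : ℚ.toℚᵘ (ℚ.1/ ℕ→ℚ (suc b)) ≡ ℚᵘ.mkℚᵘ (ℤ.+ 1) b
  toℚᵘ-1/ = invert (ℕ→ℚ (suc b)) (ℤ→ℚ≡mkℚ (ℤ.+ suc b))
    where
    invert : ∀ q .{{_ : ℚ.NonZero q}} → q ≡ ℚ.mkℚ (ℤ.+ suc b) 0 (Coprime.sym (Coprime.1-coprimeTo (suc b))) →
      ℚ.toℚᵘ (ℚ.1/ q) ≡ ℚᵘ.mkℚᵘ (ℤ.+ 1) b
    invert q refl = refl
  toℚᵘ-÷ : ℚ.toℚᵘ (ℕ→ℚ a ℚ.÷ ℕ→ℚ (suc b)) ℚᵘ.≃ ℚᵘ.mkℚᵘ (ℤ.+ a) b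
  toℚᵘ-÷ = ℚᵘₚ.≃-trans (ℚₚ.toℚᵘ-homo-* (ℕ→ℚ a) (ℚ.1/ ℕ→ℚ (suc b)))
    (ℚᵘₚ.≃-trans (ℚᵘₚ.*-cong (toℚᵘ-ℤ→ℚ (ℤ.+ a)) (ℚᵘₚ.≃-reflexive toℚᵘ-1/)) (ℚᵘ.*≡* eq))
    where
    eq : (ℤ.+ a ℤ.* ℤ.+ 1) ℤ.* ℤ.+ suc b ≡ ℤ.+ a ℤ.* ℤ.+ suc (b + 0)
    eq = cong₂ ℤ._*_ (ℤₚ.*-identityʳ (ℤ.+ a)) (cong (λ x → ℤ.+ suc x) (sym (+-identityʳ b)))

ℕ→ℚ[b*m]÷'ℕ→ℚ[b] : ∀ b m → 1 ≤ b → ℕ→ℚ (b * m) ÷' ℕ→ℚ b ≡ ℕ→ℚ m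
ℕ→ℚ[b*m]÷'ℕ→ℚ[b] (suc b) m _ = trans (ℕ→ℚ÷'ℕ→ℚ (suc b * m) b)
  (ℚₚ.toℚᵘ-injective (ℚᵘₚ.≃-trans (ℚₚ.toℚᵘ-fromℚᵘ (ℚᵘ.mkℚᵘ (ℤ.+ (suc b * m)) b))
                                  (ℚᵘₚ.≃-trans (ℚᵘ.*≡* eq) (ℚᵘₚ.≃-sym (toℚᵘ-ℤ→ℚ (ℤ.+ m))))))
  where
  eq : ℤ.+ (suc b * m) ℤ.* ℤ.+ 1 ≡ ℤ.+ m ℤ.* ℤ.+ suc b
  eq = trans (ℤₚ.*-identityʳ _) (trans (cong ℤ.+_ (*-comm (suc b) m)) (ℤₚ.pos-* m (suc b)))

ℕ→ℚ[c*n]≡ℕ→ℚ[c]÷'ℕ→ℚ[R]*ℕ→ℚ[R*n] : ∀ c R n → 1 ≤ R → ℕ→ℚ (c * n) ≡ (ℕ→ℚ c ÷' ℕ→ℚ R) ℚ.* ℕ→ℚ (R * n)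
ℕ→ℚ[c*n]≡ℕ→ℚ[c]÷'ℕ→ℚ[R]*ℕ→ℚ[R*n] c (suc b) n _ rewrite ℕ→ℚ÷'ℕ→ℚ c b =
  ℚₚ.toℚᵘ-injective (ℚᵘₚ.≃-trans (toℚᵘ-ℤ→ℚ (ℤ.+ (c * n)))
    (ℚᵘₚ.≃-sym (ℚᵘₚ.≃-trans (ℚₚ.toℚᵘ-homo-* (ℚ.fromℚᵘ (ℚᵘ.mkℚᵘ (ℤ.+ c) b)) (ℕ→ℚ (suc b * n)))
      (ℚᵘₚ.≃-trans (ℚᵘₚ.*-cong (ℚₚ.toℚᵘ-fromℚᵘ (ℚᵘ.mkℚᵘ (ℤ.+ c) b)) (toℚᵘ-ℤ→ℚ (ℤ.+ (suc b * n))))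
      (ℚᵘ.*≡* eq)))))
  where
  rearrange : ∀ c b n → c * (suc b * n) ≡ c * n * (suc b * 1)
  rearrange = solve-∀
  eq : (ℤ.+ c ℤ.* ℤ.+ (suc b * n)) ℤ.* ℤ.+ 1 ≡ ℤ.+ (c * n) ℤ.* ℤ.+ (suc b * 1)
  eq = trans (ℤₚ.*-identityʳ _) (trans (sym (ℤₚ.pos-* c (suc b * n)))
         (trans (cong ℤ.+_ (rearrange c b n)) (ℤₚ.pos-* (c * n) (suc b * 1))))

sumFin≡ℕ→ℚ-sum : ∀ r (F : Fin r → ℚ.ℚ) (a : Fin r → ℕ) → (∀ i → F i ≡ ℕ→ℚ (a i)) → sumFin r F ≡ ℕ→ℚ (sum a)
sumFin≡ℕ→ℚ-sum r F a F≗a = trans (foldr-allFin ℚ._+_ ℚ.0ℚ r F) (go r F a F≗a)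
  where
  go : ∀ r (F : Fin r → ℚ.ℚ) (a : Fin r → ℕ) → (∀ i → F i ≡ ℕ→ℚ (a i)) → Vector.foldr ℚ._+_ ℚ.0ℚ F ≡ ℕ→ℚ (sum a)
  go zero    F a F≗a = refl
  go (suc r) F a F≗a = trans (cong₂ ℚ._+_ (F≗a zero) (go r (F ∘ suc) (a ∘ suc) (F≗a ∘ suc))) (sym (ℕ→ℚ-+ (a zero) _))

ℤ-product≡+product : ∀ r (G : Fin r → ℤ.ℤ) (g : Fin r → ℕ) → (∀ i → G i ≡ ℤ.+ g i) →
  foldr (λ s acc → G s ℤ.* acc) (ℤ.+ 1) (allFin r) ≡ ℤ.+ product g
ℤ-product≡+product r G g G≗g = trans (foldr-allFin ℤ._*_ (ℤ.+ 1) r G) (go r G g G≗g)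
  where
  go : ∀ r (G : Fin r → ℤ.ℤ) (g : Fin r → ℕ) → (∀ i → G i ≡ ℤ.+ g i) → Vector.foldr ℤ._*_ (ℤ.+ 1) G ≡ ℤ.+ product g
  go zero    G g G≗g = refl
  go (suc r) G g G≗g = trans (cong₂ ℤ._*_ (G≗g zero) (go r (G ∘ suc) (g ∘ suc) (G≗g ∘ suc))) (sym (ℤₚ.pos-* (g zero) _))

pos-^ : ∀ c t → (ℤ.+ c) ℤ.^ t ≡ ℤ.+ (c ^ t)
pos-^ c zero    = refl
pos-^ c (suc t) = trans (cong (ℤ.+ c ℤ.*_) (pos-^ c t)) (sym (ℤₚ.pos-* c (c ^ t)))

minFinWith-≤ : ∀ {A : Set} (_⊓_ : A → A → A) (d : A) (_≼_ : A → A → Set) →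
  (∀ {x y z} → x ≼ y → y ≼ z → x ≼ z) → (∀ x → x ≼ x) → (∀ x y → (x ⊓ y) ≼ x) → (∀ x y → (x ⊓ y) ≼ y) →
  ∀ r (f : Fin r → A) i → minFinWith _⊓_ d r f ≼ f i
minFinWith-≤ _⊓_ d _≼_ ≼-trans ≼-refl ⊓≤ˡ ⊓≤ʳ (suc zero)    f zero    = ≼-refl (f zero)
minFinWith-≤ _⊓_ d _≼_ ≼-trans ≼-refl ⊓≤ˡ ⊓≤ʳ (suc (suc r)) f zero    = ⊓≤ˡ _ _
minFinWith-≤ _⊓_ d _≼_ ≼-trans ≼-refl ⊓≤ˡ ⊓≤ʳ (suc (suc r)) f (suc i) =
  ≼-trans (⊓≤ʳ _ _) (minFinWith-≤ _⊓_ d _≼_ ≼-trans ≼-refl ⊓≤ˡ ⊓≤ʳ (suc r) (f ∘ suc) i)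

minFinWith-attained : ∀ {A : Set} (_⊓_ : A → A → A) (d : A) → (∀ x y → (x ⊓ y ≡ x) ⊎ (x ⊓ y ≡ y)) →
  ∀ r (f : Fin r → A) → 1 ≤ r → ∃[ i ] (minFinWith _⊓_ d r f ≡ f i)
minFinWith-attained _⊓_ d sel (suc zero)    f _ = zero , refl
minFinWith-attained _⊓_ d sel (suc (suc r)) f _
  with minFinWith-attained _⊓_ d sel (suc r) (f ∘ suc) (s≤s z≤n)
     | sel (f zero) (minFinWith _⊓_ d (suc r) (f ∘ suc))
... | i , min≡fi | inj₁ ⊓≡ˡ = zero , ⊓≡ˡ
... | i , min≡fi | inj₂ ⊓≡ʳ = suc i , trans ⊓≡ʳ min≡fi

↥ε≡1+ : ∀ (ε : ℚ.ℚ) → ℚ.0ℚ ℚ.< ε → ∃[ u ] (ℚ.↥ ε ≡ ℤ.+[1+ u ])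
↥ε≡1+ (ℚ.mkℚ ℤ.+[1+ u ] _ _) _ = u , refl
↥ε≡1+ (ℚ.mkℚ (ℤ.+ zero) _ _) (ℚ.*<* (ℤ.+<+ ()))
↥ε≡1+ (ℚ.mkℚ ℤ.-[1+ _ ] _ _) (ℚ.*<* ())

toℚᵘ-ε : ∀ (ε : ℚ.ℚ) → ℚ.toℚᵘ ε ≡ ℚᵘ.mkℚᵘ (ℚ.↥ ε) (ℚ.ℚ.denominator-1 ε)
toℚᵘ-ε (ℚ.mkℚ _ _ _) = refl

-- Since ε ≥ 1/q for q = ↧ ε, it suffices to prove a/b ≤ A/B + 1/q, which clears denominators.
÷'≤÷'+ε : ∀ a b A B (ε : ℚ.ℚ) → ℚ.0ℚ ℚ.< ε → 1 ≤ b → 1 ≤ B →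
  a * B * ℚ.↧ₙ ε ≤ (A * ℚ.↧ₙ ε + B) * b →
  ℕ→ℚ a ÷' ℕ→ℚ b ℚ.≤ ℕ→ℚ A ÷' ℕ→ℚ B ℚ.+ ε
÷'≤÷'+ε a (suc b) A (suc B) ε ε>0 _ _ cleared with ↥ε≡1+ ε ε>0
... | u , ↥ε≡1+u rewrite ℕ→ℚ÷'ℕ→ℚ a b | ℕ→ℚ÷'ℕ→ℚ A B = ℚₚ.toℚᵘ-cancel-≤
  (ℚᵘₚ.≤-respˡ-≃ (ℚᵘₚ.≃-sym (ℚₚ.toℚᵘ-fromℚᵘ (ℚᵘ.mkℚᵘ (ℤ.+ a) b)))
  (ℚᵘₚ.≤-respʳ-≃ (ℚᵘₚ.≃-sym (ℚᵘₚ.≃-trans (ℚₚ.toℚᵘ-homo-+ (ℚ.fromℚᵘ (ℚᵘ.mkℚᵘ (ℤ.+ A) B)) ε)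
      (ℚᵘₚ.+-cong (ℚₚ.toℚᵘ-fromℚᵘ (ℚᵘ.mkℚᵘ (ℤ.+ A) B))
                  (ℚᵘₚ.≃-reflexive (trans (toℚᵘ-ε ε) (cong (λ z → ℚᵘ.mkℚᵘ z q′) ↥ε≡1+u))))))
  (ℚᵘ.*≤* {ℚᵘ.mkℚᵘ (ℤ.+ a) b} {ℚᵘ.mkℚᵘ (ℤ.+ A) B ℚᵘ.+ ℚᵘ.mkℚᵘ ℤ.+[1+ u ] q′} cross)))
  where
  q′ = ℚ.ℚ.denominator-1 ε
  q = suc q′
  cleared′ : a * (suc B * q) ≤ (A * q + suc u * suc B) * suc b
  cleared′ = ≤-trans (≤-reflexive (sym (*-assoc a (suc B) q)))
    (≤-trans cleared (*-monoˡ-≤ (suc b) (+-monoʳ-≤ (A * q) (m≤n*m (suc B) (suc u)))))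
  cross : ℤ.+ a ℤ.* ℤ.+ (suc B * q) ℤ.≤ (ℤ.+ A ℤ.* ℤ.+ q ℤ.+ ℤ.+[1+ u ] ℤ.* ℤ.+ suc B) ℤ.* ℤ.+ suc b
  cross = subst₂ ℤ._≤_ (ℤₚ.pos-* a (suc B * q))
    (trans (ℤₚ.pos-* (A * q + suc u * suc B) (suc b))
      (cong (ℤ._* ℤ.+ suc b) (cong₂ ℤ._+_ (ℤₚ.pos-* A q) (ℤₚ.pos-* (suc u) (suc B)))))
    (ℤ.+≤+ cleared′)

÷'-ε≤÷' : ∀ a b A B (ε : ℚ.ℚ) → ℚ.0ℚ ℚ.< ε → 1 ≤ b → 1 ≤ B →
  A * ℚ.↧ₙ ε * b ≤ a * B * ℚ.↧ₙ ε + B * b →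
  ℕ→ℚ A ÷' ℕ→ℚ B ℚ.- ε ℚ.≤ ℕ→ℚ a ÷' ℕ→ℚ b
÷'-ε≤÷' a (suc b) A (suc B) ε ε>0 _ _ cleared with ↥ε≡1+ ε ε>0
... | u , ↥ε≡1+u rewrite ℕ→ℚ÷'ℕ→ℚ a b | ℕ→ℚ÷'ℕ→ℚ A B = ℚₚ.toℚᵘ-cancel-≤
  (ℚᵘₚ.≤-respʳ-≃ (ℚᵘₚ.≃-sym (ℚₚ.toℚᵘ-fromℚᵘ (ℚᵘ.mkℚᵘ (ℤ.+ a) b)))
  (ℚᵘₚ.≤-respˡ-≃ (ℚᵘₚ.≃-sym (ℚᵘₚ.≃-trans (ℚₚ.toℚᵘ-homo-+ (ℚ.fromℚᵘ (ℚᵘ.mkℚᵘ (ℤ.+ A) B)) (ℚ.- ε))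
      (ℚᵘₚ.+-cong (ℚₚ.toℚᵘ-fromℚᵘ (ℚᵘ.mkℚᵘ (ℤ.+ A) B))
        (ℚᵘₚ.≃-trans (ℚₚ.toℚᵘ-homo‿- ε)
                     (ℚᵘₚ.≃-reflexive (cong ℚᵘ.-_ (trans (toℚᵘ-ε ε) (cong (λ z → ℚᵘ.mkℚᵘ z q′) ↥ε≡1+u))))))))
  (ℚᵘ.*≤* {ℚᵘ.mkℚᵘ (ℤ.+ A) B ℚᵘ.+ ℚᵘ.mkℚᵘ ℤ.-[1+ u ] q′} {ℚᵘ.mkℚᵘ (ℤ.+ a) b} cross)))
  where
  q′ = ℚ.ℚ.denominator-1 ε
  q = suc q′
  x = A * q * suc b
  y = suc u * suc B * suc b
  z = a * (suc B * q)
  cleared′ : x ≤ z + y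
  cleared′ = ≤-trans cleared (+-mono-≤ (≤-reflexive (*-assoc a (suc B) q)) (*-monoˡ-≤ (suc b) (m≤n*m (suc B) (suc u))))
  expand : ∀ (X Y W b : ℤ.ℤ) → (X ℤ.+ (ℤ.- Y) ℤ.* W) ℤ.* b ≡ X ℤ.* b ℤ.- Y ℤ.* W ℤ.* b
  expand = ℤ-Solver.solve-∀
  lhs : (ℤ.+ A ℤ.* ℤ.+ q ℤ.+ ℤ.-[1+ u ] ℤ.* ℤ.+ suc B) ℤ.* ℤ.+ suc b ≡ x ℤ.⊖ y
  lhs = begin
    (ℤ.+ A ℤ.* ℤ.+ q ℤ.+ (ℤ.- ℤ.+ suc u) ℤ.* ℤ.+ suc B) ℤ.* ℤ.+ suc b
      ≡⟨ expand (ℤ.+ A ℤ.* ℤ.+ q) (ℤ.+ suc u) (ℤ.+ suc B) (ℤ.+ suc b) ⟩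
    ℤ.+ A ℤ.* ℤ.+ q ℤ.* ℤ.+ suc b ℤ.- ℤ.+ suc u ℤ.* ℤ.+ suc B ℤ.* ℤ.+ suc b
      ≡⟨ cong₂ ℤ._-_ (trans (cong (ℤ._* ℤ.+ suc b) (sym (ℤₚ.pos-* A q))) (sym (ℤₚ.pos-* (A * q) (suc b))))
                     (trans (cong (ℤ._* ℤ.+ suc b) (sym (ℤₚ.pos-* (suc u) (suc B)))) (sym (ℤₚ.pos-* (suc u * suc B) (suc b)))) ⟩
    ℤ.+ x ℤ.- ℤ.+ y
      ≡⟨ ℤₚ.[+m]-[+n]≡m⊖n x y ⟩
    x ℤ.⊖ y ∎
    where open ≡-Reasoning
  cross : (ℤ.+ A ℤ.* ℤ.+ q ℤ.+ ℤ.-[1+ u ] ℤ.* ℤ.+ suc B) ℤ.* ℤ.+ suc b ℤ.≤ ℤ.+ a ℤ.* ℤ.+ (suc B * q)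
  cross = subst₂ ℤ._≤_ (sym lhs) (trans (trans (ℤₚ.⊖-≥ (m≤n+m y z)) (cong ℤ.+_ (m+n∸n≡m z y))) (ℤₚ.pos-* a (suc B * q)))
    (ℤₚ.⊖-monoˡ-≤ y cleared′)

multinomial≡multinomialℕ : ∀ k r (t : Fin r → ℕ) → sum t ≡ k → multinomial k r t ≡ ℕ→ℚ (multinomialℕ t)
multinomial≡multinomialℕ k r t ∣t∣≡k = trans
  (cong₂ (λ a b → ℕ→ℚ a ÷' ℕ→ℚ b)
    (trans (cong _! (sym ∣t∣≡k)) (sum!≡product!*multinomial t)) (foldr-allFin _*_ 1 r (λ s → t s !)))
  (ℕ→ℚ[b*m]÷'ℕ→ℚ[b] (product (λ s → t s !)) (multinomialℕ t) (product-pos _ (λ s → 1≤n! (t s))))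

term≡numerator÷' : ∀ {k r} (j : Fin r → ℕ) σ → 1 ≤ r → Valid k r j σ → ∀ i →
  term k r j σ i ≡
  ℕ→ℚ (numerator (partWeight r j σ) (colourType j σ) i) ÷' ℕ→ℚ (k ^ k * r ^ (k ∸ 1) * partWeight r j σ i)
term≡numerator÷' {k} {r} j σ 1≤r valid i = cong₂ _÷'_ (sumFin≡ℕ→ℚ-sum r _ _ summand) (cong ℤ→ℚ denominator)
  where
  c = partWeight r j σ
  T = colourType j σ
  denominator : ℤ.+ (k ^ k * r ^ (k ∸ 1)) ℤ.* rjσ r j σ i ≡ ℤ.+ (k ^ k * r ^ (k ∸ 1) * c i)
  denominator = trans (cong (ℤ.+ (k ^ k * r ^ (k ∸ 1)) ℤ.*_) (rjσ≡partWeight j σ 1≤r valid i))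
    (sym (ℤₚ.pos-* (k ^ k * r ^ (k ∸ 1)) (c i)))
  summand : ∀ l → ℤ→ℚ (jls j σ l i) ℚ.* multinomial k r (T l)
      ℚ.* ℤ→ℚ (foldr (λ s acc → (rjσ r j σ s ℤ.^ T l s) ℤ.* acc) (ℤ.+ 1) (allFin r))
      ≡ ℕ→ℚ (T l i * multinomialℕ (T l) * product (λ s → c s ^ T l s))
  summand l = begin
    ℤ→ℚ (jls j σ l i) ℚ.* multinomial k r (T l) ℚ.* ℤ→ℚ (foldr (λ s acc → (rjσ r j σ s ℤ.^ T l s) ℤ.* acc) (ℤ.+ 1) (allFin r))
      ≡⟨ cong₂ ℚ._*_ (cong₂ ℚ._*_ (cong ℤ→ℚ (jls≡colourType j σ valid l i))
                                  (multinomial≡multinomialℕ k r (T l) (sum-colourType j σ valid l)))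
                     (cong ℤ→ℚ (ℤ-product≡+product r _ (λ s → c s ^ T l s)
                       (λ s → trans (cong (ℤ._^ T l s) (rjσ≡partWeight j σ 1≤r valid s)) (pos-^ (c s) (T l s))))) ⟩
    ℕ→ℚ (T l i) ℚ.* ℕ→ℚ (multinomialℕ (T l)) ℚ.* ℕ→ℚ (product (λ s → c s ^ T l s))
      ≡⟨ cong (ℚ._* ℕ→ℚ (product (λ s → c s ^ T l s))) (ℕ→ℚ-* (T l i) (multinomialℕ (T l))) ⟨
    ℕ→ℚ (T l i * multinomialℕ (T l)) ℚ.* ℕ→ℚ (product (λ s → c s ^ T l s))
      ≡⟨ ℕ→ℚ-* (T l i * multinomialℕ (T l)) (product (λ s → c s ^ T l s)) ⟨
    ℕ→ℚ (T l i * multinomialℕ (T l) * product (λ s → c s ^ T l s)) ∎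
    where open ≡-Reasoning

module Bounds {d r : ℕ} (1≤d : 1 ≤ d) (2≤r : 2 ≤ r) (j : Fin r → ℕ) (σ : Sign) (valid : Valid (suc d) r j σ)
              (ε : ℚ.ℚ) (ε>0 : ℚ.0ℚ ℚ.< ε) where

  private
    k = suc d
    c = partWeight r j σ
    T = colourType j σ
    X = numerator c T
    q = ℚ.↧ₙ ε
    1≤r : 1 ≤ r
    1≤r = ≤-trans (s≤s z≤n) 2≤r
    1≤c : ∀ s → 1 ≤ c s
    1≤c = 1≤partWeight j σ 2≤r valid
    ∣T∣≡k : ∀ l → sum (T l) ≡ k
    ∣T∣≡k = sum-colourType j σ valid

    B : Fin r → ℕ
    B i = k ^ k * r ^ d * c i

  threshold : ℕ
  threshold = k * suc (sum (λ i → X i * q + B i))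

  private
    1≤B : ∀ i → 1 ≤ B i
    1≤B i = *-mono-≤ (*-mono-≤ (1≤m^n k (s≤s z≤n)) (1≤m^n d 1≤r)) (1≤c i)

    term≡X÷'B : ∀ i → term k r j σ i ≡ ℕ→ℚ (X i) ÷' ℕ→ℚ (B i)
    term≡X÷'B = term≡numerator÷' j σ 1≤r valid

    normDeg≡ : ∀ {N} (H : ColKGraph k r N) → normDeg H ≡ ℕ→ℚ (δ₁ H) ÷' ℕ→ℚ (binom (N ∸ 1) d)
    normDeg≡ {N} H = cong (λ x → ℕ→ℚ (δ₁ H) ÷' ℕ→ℚ x) (sym (binom≡C (N ∸ 1) d))

  module _ {n : ℕ} (threshold≤n : threshold ≤ n) where

    private
      N = k * r * n
      Cᴺ = binom (N ∸ 1) d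
      Tot = sum (λ i → X i * q + B i)
      Tot*k≤n : Tot * k ≤ n
      Tot*k≤n = ≤-trans (≤-trans (≤-reflexive (*-comm Tot k)) (*-monoʳ-≤ k (n≤1+n Tot))) threshold≤n
      k≤n : k ≤ n
      k≤n = ≤-trans (m≤m*n k (suc Tot)) threshold≤n
      1≤n : 1 ≤ n
      1≤n = ≤-trans (s≤s z≤n) k≤n
      small-upper : ∀ i → (X i * q + B i) * d ≤ n
      small-upper i = ≤-trans (*-mono-≤ (≤-sum (λ i → X i * q + B i) i) (n≤1+n d)) Tot*k≤n
      small-lower : ∀ i → X i * q * k ≤ n
      small-lower i = ≤-trans (*-monoˡ-≤ k (≤-trans (m≤m+n (X i * q) (B i)) (≤-sum (λ i → X i * q + B i) i))) Tot*k≤n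
      n+k≤N : n + k ≤ N
      n+k≤N = begin
        n + k         ≤⟨ +-monoʳ-≤ n (m≤m*n k n {{>-nonZero 1≤n}}) ⟩
        n + k * n     ≤⟨ +-monoˡ-≤ (k * n) (m≤n*m n k) ⟩
        k * n + k * n ≡⟨ k*n+k*n≡k*2*n k n ⟩
        k * 2 * n     ≤⟨ *-monoˡ-≤ n (*-monoʳ-≤ k 2≤r) ⟩
        N             ∎
        where
        open ≤-Reasoning
        k*n+k*n≡k*2*n : ∀ k n → k * n + k * n ≡ k * 2 * n
        k*n+k*n≡k*2*n = solve-∀
      n≤N∸k : n ≤ N ∸ k
      n≤N∸k = m+n≤o⇒m≤o∸n n n+k≤N
      1≤N : 1 ≤ N
      1≤N = ≤-trans 1≤n (≤-trans (m≤m+n n k) n+k≤N)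
      [N∸k]^d≤d!Cᴺ : (N ∸ k) ^ d ≤ d ! * Cᴺ
      [N∸k]^d≤d!Cᴺ = [N∸1-d]^d≤d!*binom N d 1≤N
      1≤Cᴺ : 1 ≤ Cᴺ
      1≤Cᴺ = 1≤m*n⇒1≤n (d !) (≤-trans (1≤m^n d (≤-trans 1≤n n≤N∸k)) [N∸k]^d≤d!Cᴺ)
      size≡ : ∀ s → (ℤ→ℚ (rjσ r j σ s) ÷' ℕ→ℚ (r * k)) ℚ.* ℕ→ℚ N ≡ ℕ→ℚ (c s * n)
      size≡ s = trans
        (cong₂ (λ a b → (ℤ→ℚ a ÷' ℕ→ℚ (r * k)) ℚ.* ℕ→ℚ b) (rjσ≡partWeight j σ 1≤r valid s) (cong (_* n) (*-comm k r)))
        (sym (ℕ→ℚ[c*n]≡ℕ→ℚ[c]÷'ℕ→ℚ[R]*ℕ→ℚ[R*n] (c s) (r * k) n (*-mono-≤ 1≤r (s≤s z≤n))))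

    normDeg≤target+ε : ∀ H → InF k r j σ N H → normDeg H ℚ.≤ target k r j σ ℚ.+ ε
    normDeg≤target+ε H (_ , p , sizes , typed) =
      subst₂ (λ a b → a ℚ.≤ b ℚ.+ ε) (sym (normDeg≡ H)) (sym (trans target≡term (term≡X÷'B i)))
        (÷'≤÷'+ε (δ₁ H) Cᴺ (X i) (B i) ε ε>0 1≤Cᴺ (1≤B i) cleared)
      where
      attained = minFinWith-attained ℚ._⊓_ ℚ.0ℚ ℚₚ.⊓-sel r (term k r j σ) 1≤r
      i = proj₁ attained
      target≡term = proj₂ attained
      partSize≡ : ∀ s → partSize p s ≡ c s * n
      partSize≡ s = ℕ→ℚ-injective _ _ (trans (sizes s) (size≡ s))
      typeOf≡ : ∀ e l → colour H e ≡ just l → ∀ s → typeOf p e s ≡ T l s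
      typeOf≡ e l eq s = ℤₚ.+-injective (trans (typed e l eq s) (jls≡colourType j σ valid l s))
      inhabited = inhabited-part p i (subst (1 ≤_) (sym (partSize≡ i)) (*-mono-≤ (1≤c i) 1≤n))
      v = proj₁ inhabited
      D = typeDegree p v T
      δ₁≤D : δ₁ H ≤ D
      δ₁≤D = ≤-trans (minFinWith-≤ _⊓_ 0 _≤_ ≤-trans (λ _ → ≤-refl) m⊓n≤m m⊓n≤n N (degree H) v)
                     (degree≤typeDegree H p T typeOf≡ v)
      D≤ : c i * n * k ! * D ≤ n ^ k * X i
      D≤ = subst (λ s → c s * n * k ! * D ≤ n ^ k * X s) (proj₂ inhabited) (typeDegree≤ p v c n k T partSize≡ ∣T∣≡k)
      cleared : δ₁ H * B i * q ≤ (X i * q + B i) * Cᴺ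
      cleared = upper-estimate d r n q (c i) (X i) D (δ₁ H) Cᴺ 1≤d 1≤r 1≤n (1≤c i) D≤ [N∸k]^d≤d!Cᴺ (small-upper i) δ₁≤D

    canonical-target-ε≤normDeg : ∃[ H ] (InF k r j σ N H × (target k r j σ ℚ.- ε ℚ.≤ normDeg H))
    canonical-target-ε≤normDeg = H , inF ,
      ℚₚ.≤-trans (ℚₚ.+-monoˡ-≤ (ℚ.- ε) target≤term)
        (subst₂ (λ a b → a ℚ.- ε ℚ.≤ b) (sym (term≡X÷'B i)) (sym (normDeg≡ H))
          (÷'-ε≤÷' (δ₁ H) Cᴺ (X i) (B i) ε ε>0 1≤Cᴺ (1≤B i) cleared))
      where
      ∑cn≡N : sum (λ s → c s * n) ≡ N
      ∑cn≡N = begin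
        sum (λ s → c s * n) ≡⟨ sum-cong-≗ (λ s → *-comm (c s) n) ⟩
        sum (λ s → n * c s) ≡⟨ *-distribˡ-sum n c ⟨
        n * sum c           ≡⟨ cong (n *_) (sum-partWeight j σ 1≤r valid) ⟩
        n * (k * r)         ≡⟨ *-comm n (k * r) ⟩
        N                   ∎
        where open ≡-Reasoning
      p = partitionWithSizes (λ s → c s * n) ∑cn≡N
      partSize≡ : ∀ s → partSize p s ≡ c s * n
      partSize≡ = partSize-partitionWithSizes (λ s → c s * n) ∑cn≡N
      H = canonicalGraph p T ∣T∣≡k
      inF : InF k r j σ N H
      inF = divides n (*-comm (k * r) n) , p , (λ s → trans (cong ℕ→ℚ (partSize≡ s)) (sym (size≡ s))) ,
        λ e l eq s → trans (cong ℤ.+_ (colourByType-just p T e eq s)) (sym (jls≡colourType j σ valid l s))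
      attained = minFinWith-attained _⊓_ 0 ⊓-sel N (degree H) 1≤N
      v = proj₁ attained
      i = p v
      target≤term : target k r j σ ℚ.≤ term k r j σ i
      target≤term =
        minFinWith-≤ ℚ._⊓_ ℚ.0ℚ ℚ._≤_ ℚₚ.≤-trans (λ _ → ℚₚ.≤-refl) ℚₚ.p⊓q≤p ℚₚ.p⊓q≤q r (term k r j σ) i
      D = typeDegree p v T
      D≤δ₁ : D ≤ δ₁ H
      D≤δ₁ = subst (D ≤_) (sym (proj₂ attained)) (typeDegree≤degree p T ∣T∣≡k (colourType-injective j σ valid) v)
      cleared : X i * q * Cᴺ ≤ δ₁ H * B i * q + B i * Cᴺ
      cleared = ≤-trans
        (lower-estimate d r n q (c i) (X i) D Cᴺ 1≤n (1≤c i) k≤n (≤typeDegree p v c n k T partSize≡ ∣T∣≡k 1≤c)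
          [N∸k]^d≤d!Cᴺ (d!*binom≤N^d N d) (small-lower i) n≤N∸k)
        (+-monoˡ-≤ (B i * Cᴺ) (*-monoˡ-≤ q (*-monoˡ-≤ (B i) D≤δ₁)))

lemma4p1 : (k r : ℕ) → 2 ≤ k → 2 ≤ r → (j : Fin r → ℕ) (σ : Sign) → Valid k r j σ →
    (ε : ℚ.ℚ) → ℚ.0ℚ ℚ.< ε → ∃[ n₀ ] ((n : ℕ) → n₀ ≤ n →
      ((H : ColKGraph k r (k * r * n)) → InF k r j σ (k * r * n) H →
          normDeg H ℚ.≤ target k r j σ ℚ.+ ε)
      × (∃[ H ] (InF k r j σ (k * r * n) H × (target k r j σ ℚ.- ε ℚ.≤ normDeg H))))
lemma4p1 (suc (suc d′)) r (s≤s (s≤s _)) 2≤r j σ valid ε ε>0 =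
  threshold , λ n threshold≤n → normDeg≤target+ε threshold≤n , canonical-target-ε≤normDeg threshold≤n
  where open Bounds (s≤s z≤n) 2≤r j σ valid ε ε>0
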